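{- Let $n=\prod_i p_i^{r_i}$ be a composite positive integer, with distinct primes $p_i$. Let $f\in\mathbb{Z}[x]$ be monic of degree 2 with discriminant $\Delta$, and suppose $\left(\frac{\Delta}{n}\right)=-1$. Then $n$ is a degree-2 Frobenius pseudoprime with respect to $f$ if and only if all of the following hold: (1) $\Delta$ is a unit modulo $n$, and $0$ is not a root of $f$ modulo $p_i$ for every $i$; (2) $\mathrm{gcmd}(x^n-x,f(x))=1$ modulo $p_i^{r_i}$ for every $i$; (3) $\mathrm{gcmd}(x^{n^2}-x,f(x))=f(x)$ modulo $p_i^{r_i}$ for every $i$; (4) for every $i$ and every root $\alpha$ of $f$ modulo $p_i^{r_i}$, the element $\alpha^n$ is also a root of $f$ modulo $p_i^{r_i}$. In particular, conditions (1)–(4) are sufficient to ensure that $\mathrm{gcmd}(x^n-x,f(x))$ and $\mathrm{gcmd}(x^{n^2}-x,f(x))$ exist modulo $n$.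
   Context: For a positive integer $m$ and monic $g_1,g_2,h\in(\mathbb{Z}/m\mathbb{Z})[x]$, "$\mathrm{gcmd}(g_1,g_2)=h$ modulo $m$" means that the ideal generated by $g_1,g_2$ in $(\mathbb{Z}/m\mathbb{Z})[x]$ equals the ideal generated by $h$. Such an $h$ need not exist. A root of $f$ modulo $p^r$ means a root of $f$ in the ring $(\mathbb{Z}/p^r\mathbb{Z})[y]/\langle f(y)\rangle$, which contains $\mathbb{Z}/p^r\mathbb{Z}$. A composite $n$ is a degree-2 Frobenius pseudoprime with respect to a monic quadratic $f\in\mathbb{Z}[x]$ with discriminant $\Delta$ if all of the following hold: (1) $\gcd(n,f(0)\Delta)=1$; (2) modulo $n$, the polynomials $F_1=\mathrm{gcmd}(x^n-x,f)$, $f_1=f/F_1$, $F_2=\mathrm{gcmd}(x^{n^2}-x,f_1)$ and $f_2=f_1/F_2$ all exist, and $f_2=1$; (3) $F_2(x)\mid F_2(x^n)$ modulo $n$; (4) $(-1)^{\deg(F_2)/2}=\left(\frac{\Delta}{n}\right)$ (Jacobi symbol). -}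

module Defs where

open import Data.Nat as ℕ using (ℕ; zero; suc; _<_; _≤_)
open import Data.Nat.Divisibility as ℕD using ()
open import Data.Nat.Primality using (Prime; Composite)
open import Data.Nat.Coprimality using (Coprime)
open import Data.Integer as ℤ using (ℤ; +_; _+_; _-_; _*_; -_; ∣_∣)
open import Data.Integer.Divisibility as ℤD using ()
open import Data.List using (List; []; _∷_; replicate; _++_; foldr)
open import Data.Product using (Σ; ∃; ∃-syntax; _×_; _,_)
open import Relation.Nullary using (¬_)

infix 4 _≡_[mod_] _≈_[modP_] _≈R_[mod_]

_≡_[mod_] : ℤ → ℤ → ℕ → Set
a ≡ b [mod m ] = (+ m) ℤD.∣ (a - b)

UnitMod : ℕ → ℤ → Set
UnitMod m a = ∃[ u ] (a * u ≡ + 1 [mod m ])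

-- Polynomials: lists of integer coefficients, lowest degree first.
-- A polynomial over ℤ/mℤ is represented by an integer polynomial,
-- two being equal in (ℤ/mℤ)[x] iff all coefficients agree mod m.

Poly : Set
Poly = List ℤ

coeff : Poly → ℕ → ℤ
coeff []       _       = + 0
coeff (a ∷ p)  zero    = a
coeff (a ∷ p)  (suc k) = coeff p k

infixl 6 _⊕_
infixl 7 _⊗_ _·_

_⊕_ : Poly → Poly → Poly
[]      ⊕ q       = q
(a ∷ p) ⊕ []      = a ∷ p
(a ∷ p) ⊕ (b ∷ q) = (a + b) ∷ (p ⊕ q)

negP : Poly → Poly
negP []      = []
negP (a ∷ p) = (- a) ∷ negP p

_⊖_ : Poly → Poly → Poly
p ⊖ q = p ⊕ negP q

_·_ : ℤ → Poly → Poly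
a · []      = []
a · (b ∷ p) = (a * b) ∷ (a · p)

_⊗_ : Poly → Poly → Poly
[]      ⊗ q = []
(a ∷ p) ⊗ q = (a · q) ⊕ (+ 0 ∷ (p ⊗ q))

X^ : ℕ → Poly
X^ k = replicate k (+ 0) ++ (+ 1 ∷ [])

oneP : Poly
oneP = + 1 ∷ []

compose : Poly → Poly → Poly
compose p q = foldr (λ a acc → (a ∷ []) ⊕ (q ⊗ acc)) [] p

_≈_[modP_] : Poly → Poly → ℕ → Set
p ≈ q [modP m ] = ∀ k → coeff p k ≡ coeff q k [mod m ]

MonicDeg : ℕ → Poly → ℕ → Set
MonicDeg m p d = (coeff p d ≡ + 1 [mod m ]) × (∀ k → d < k → coeff p k ≡ + 0 [mod m ])

Monic : ℕ → Poly → Set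
Monic m p = ∃[ d ] MonicDeg m p d

DividesP : ℕ → Poly → Poly → Set
DividesP m h g = ∃[ q ] (g ≈ h ⊗ q [modP m ])

InIdeal₂ : ℕ → Poly → Poly → Poly → Set
InIdeal₂ m g₁ g₂ h = ∃[ a ] ∃[ b ] (h ≈ a ⊗ g₁ ⊕ b ⊗ g₂ [modP m ])

-- "gcmd(g₁,g₂) = h modulo m": h monic and ⟨g₁,g₂⟩ = ⟨h⟩ in (ℤ/mℤ)[x]
Gcmd : ℕ → Poly → Poly → Poly → Set
Gcmd m g₁ g₂ h = Monic m h × InIdeal₂ m g₁ g₂ h × DividesP m h g₁ × DividesP m h g₂

fPoly : ℤ → ℤ → Poly
fPoly b c = c ∷ b ∷ + 1 ∷ []

disc : ℤ → ℤ → ℤ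
disc b c = b * b - + 4 * c

-- The ring (ℤ/mℤ)[y]/⟨f(y)⟩ for f = y² + b y + c.  Since f is monic,
-- every element is uniquely u + v·y; an element is stored as (u , v)
-- and multiplication uses y² = - b y - c.

QR : Set
QR = ℤ × ℤ

_≈R_[mod_] : QR → QR → ℕ → Set
(u , v) ≈R (u' , v') [mod m ] = (u ≡ u' [mod m ]) × (v ≡ v' [mod m ])

addR : QR → QR → QR
addR (u , v) (u' , v') = (u + u') , (v + v')

mulR : ℤ → ℤ → QR → QR → QR
mulR b c (u , v) (u' , v') =
  (u * u' - c * (v * v')) , (u * v' + u' * v - b * (v * v'))

powR : ℤ → ℤ → QR → ℕ → QR
powR b c α zero    = (+ 1 , + 0)
powR b c α (suc k) = mulR b c α (powR b c α k)

evalF : ℤ → ℤ → QR → QR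
evalF b c α = addR (addR (mulR b c α α) (mulR b c (b , + 0) α)) (c , + 0)

IsRoot : ℕ → ℤ → ℤ → QR → Set
IsRoot m b c α = evalF b c α ≈R (+ 0 , + 0) [mod m ]

data Odd : ℕ → Set where
  odd : ∀ k → Odd (suc (2 ℕ.* k))

data Legendre (a : ℤ) (p : ℕ) : ℤ → Set where
  leg-zero : (+ p) ℤD.∣ a → Legendre a p (+ 0)
  leg-res  : ¬ ((+ p) ℤD.∣ a) → (∃[ t ] (t * t ≡ a [mod p ])) → Legendre a p (+ 1)
  leg-non  : ¬ ((+ p) ℤD.∣ a) → ¬ (∃[ t ] (t * t ≡ a [mod p ])) → Legendre a p (- (+ 1))

data Jacobi (a : ℤ) : ℕ → ℤ → Set where
  jac-one : Jacobi a 1 (+ 1)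
  jac-mul : ∀ {p m s t} → Prime p → Odd p → Legendre a p t → Jacobi a m s →
            Jacobi a (p ℕ.* m) (t * s)

xn-x : ℕ → Poly
xn-x k = X^ k ⊖ X^ 1

FrobeniusPP2 : ℕ → ℤ → ℤ → Set
FrobeniusPP2 n b c =
  Composite n ×
  Coprime n ∣ c * disc b c ∣ ×
  ∃[ F₁ ] ∃[ f₁ ] ∃[ F₂ ] ∃[ f₂ ]
    ( Gcmd n (xn-x n) (fPoly b c) F₁
    × (fPoly b c ≈ F₁ ⊗ f₁ [modP n ])
    × Gcmd n (xn-x (n ℕ.* n)) f₁ F₂
    × (f₁ ≈ F₂ ⊗ f₂ [modP n ])
    × (f₂ ≈ oneP [modP n ])
    × DividesP n F₂ (compose F₂ (X^ n))
    × ∃[ d ] (MonicDeg n F₂ d × Jacobi (disc b c) n ((- (+ 1)) ℤ.^ (d ℕ./ 2))))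

ExactPrimePower : ℕ → ℕ → ℕ → Set
ExactPrimePower p r n =
  Prime p × 1 ≤ r × (p ℕ.^ r) ℕD.∣ n × ¬ ((p ℕ.^ suc r) ℕD.∣ n)

Cond1 Cond2 Cond3 Cond4 : ℕ → ℤ → ℤ → Set
Cond1 n b c = UnitMod n (disc b c) ×
  (∀ p → Prime p → p ℕD.∣ n → ¬ IsRoot p b c (+ 0 , + 0))
Cond2 n b c = ∀ p r → ExactPrimePower p r n →
  Gcmd (p ℕ.^ r) (xn-x n) (fPoly b c) oneP
Cond3 n b c = ∀ p r → ExactPrimePower p r n →
  Gcmd (p ℕ.^ r) (xn-x (n ℕ.* n)) (fPoly b c) (fPoly b c)
Cond4 n b c = ∀ p r → ExactPrimePower p r n → ∀ α →
  IsRoot (p ℕ.^ r) b c α → IsRoot (p ℕ.^ r) b c (powR b c α n)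

-- Since (Δ/n) = −1, the Jacobi condition of a Frobenius pseudoprime forces
-- ⌊deg F₂ / 2⌋ to be odd, and deg F₁ + deg F₂ = 2 then leaves F₁ = 1 and
-- F₂ = f₁ = f modulo n.  The gcmd conditions modulo n restrict to every
-- p^r ∣ n, and F₂ ∣ F₂(xⁿ) says that αⁿ is a root whenever α is, because
-- evaluation at a root α is a ring map to ℤ[y]/⟨f⟩.  Conversely, taking
-- F₁ = 1 and F₂ = f, the conditions at the prime powers glue to conditions
-- modulo n by the Chinese remainder theorem; f ∣ f(xⁿ) modulo p^r holds because
-- the remainder of f(xⁿ) on division by the monic f is its value f(yⁿ) at the
-- generic root y, which vanishes by (4).

module Submission where

open import Defs
open import Data.Nat as ℕ using (ℕ; zero; suc; _<_; z≤n; s≤s)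
import Data.Nat.Properties as ℕ
open import Data.Nat.Divisibility as ℕD using (_∣_; _∤_; divides; ∣-trans)
open import Data.Nat.Primality using (Composite; Prime; composite⇒nonZero; composite⇒nonTrivial; euclidsLemma)
open import Data.Nat.Coprimality using (Coprime; coprime-Bézout; coprime-divisor)
open import Data.Integer as ℤ using (ℤ; +_; -_; ∣_∣)
import Data.Integer.Properties as ℤ
import Data.Integer.Divisibility.Signed as ℤS
open import Data.Product using (∃-syntax; _×_; _,_; proj₁; proj₂)
open import Data.List using (List; []; _∷_)
open import Data.Integer.Tactic.RingSolver using (solve; solve-∀)
open import Data.Sum using ([_,_]′)
open import Function using (_∘_)
open import Function.Bundles using (_⇔_; mk⇔)
open import Relation.Nullary using (¬_; contradiction)
open import Relation.Binary.PropositionalEquality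
open import Relation.Binary.Bundles using (Setoid)
import Relation.Binary.Reasoning.Setoid as SetoidReasoning
open import Level using (0ℓ)

module Congruence where

  open import Data.Integer using (_+_; _-_; _*_)
  open import Data.Nat.GCD using (module Bézout)

  infix 4 _≡_⟨mod_⟩

  -- _≡_[mod_] unfolds to a divisibility of |a - b| and so does not determine a
  -- and b for implicit-argument inference; this record carries the quotient.
  record _≡_⟨mod_⟩ (a b M : ℤ) : Set where
    constructor mod-by
    field
      quotient : ℤ
      equation : a ≡ b + quotient * M

  from-[mod] : ∀ {m a b} → a ≡ b [mod m ] → a ≡ b ⟨mod + m ⟩
  from-[mod] {m} {a} {b} a≡b with ℤS.∣ᵤ⇒∣ a≡b
  ... | ℤS.divides k eq = mod-by k (begin
    a             ≡⟨ solve (a ∷ b ∷ []) ⟩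
    b + (a - b)   ≡⟨ cong (λ z → b + z) eq ⟩
    b + k * + m   ∎)
    where open ≡-Reasoning

  to-[mod] : ∀ {m a b} → a ≡ b ⟨mod + m ⟩ → a ≡ b [mod m ]
  to-[mod] {m} {b = b} (mod-by k refl) = ℤS.∣⇒∣ᵤ (ℤS.divides k (lemma b k (+ m)))
    where
    lemma : ∀ b k M → b + k * M - b ≡ k * M
    lemma b k M = solve (b ∷ k ∷ M ∷ [])

  ≡-mod-refl : ∀ {M a} → a ≡ a ⟨mod M ⟩
  ≡-mod-refl {M} {a} = mod-by (+ 0) (solve (a ∷ M ∷ []))

  ≡-mod-reflexive : ∀ {M a b} → a ≡ b → a ≡ b ⟨mod M ⟩
  ≡-mod-reflexive refl = ≡-mod-refl

  ≡-mod-resp : ∀ {M a a' b b'} → a ≡ a' → b ≡ b' → a' ≡ b' ⟨mod M ⟩ → a ≡ b ⟨mod M ⟩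
  ≡-mod-resp refl refl a'≡b' = a'≡b'

  ≡-mod-sym : ∀ {M a b} → a ≡ b ⟨mod M ⟩ → b ≡ a ⟨mod M ⟩
  ≡-mod-sym {M} {b = b} (mod-by k refl) = mod-by (- k) (solve (b ∷ k ∷ M ∷ []))

  ≡-mod-trans : ∀ {M a b c} → a ≡ b ⟨mod M ⟩ → b ≡ c ⟨mod M ⟩ → a ≡ c ⟨mod M ⟩
  ≡-mod-trans {M} {c = c} (mod-by k refl) (mod-by l refl) =
    mod-by (l + k) (solve (c ∷ k ∷ l ∷ M ∷ []))

  ≡-mod-setoid : ℤ → Setoid 0ℓ 0ℓ
  ≡-mod-setoid M = record
    { Carrier       = ℤ
    ; _≈_           = _≡_⟨mod M ⟩
    ; isEquivalence = record { refl = ≡-mod-refl ; sym = ≡-mod-sym ; trans = ≡-mod-trans } }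

  +-cong-mod : ∀ {M a b a' b'} → a ≡ b ⟨mod M ⟩ → a' ≡ b' ⟨mod M ⟩ → a + a' ≡ b + b' ⟨mod M ⟩
  +-cong-mod {M} {b = b} {b' = b'} (mod-by k refl) (mod-by l refl) =
    mod-by (k + l) (solve (b ∷ b' ∷ k ∷ l ∷ M ∷ []))

  sub-cong-mod : ∀ {M a b a' b'} → a ≡ b ⟨mod M ⟩ → a' ≡ b' ⟨mod M ⟩ → a - a' ≡ b - b' ⟨mod M ⟩
  sub-cong-mod {M} {b = b} {b' = b'} (mod-by k refl) (mod-by l refl) =
    mod-by (k - l) (solve (b ∷ b' ∷ k ∷ l ∷ M ∷ []))

  *-cong-mod : ∀ {M a b a' b'} → a ≡ b ⟨mod M ⟩ → a' ≡ b' ⟨mod M ⟩ → a * a' ≡ b * b' ⟨mod M ⟩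
  *-cong-mod {M} {b = b} {b' = b'} (mod-by k refl) (mod-by l refl) =
    mod-by (k * b' + b * l + k * l * M) (solve (b ∷ b' ∷ k ∷ l ∷ M ∷ []))

  *-congˡ-mod : ∀ {M a b} c → a ≡ b ⟨mod M ⟩ → c * a ≡ c * b ⟨mod M ⟩
  *-congˡ-mod c = *-cong-mod (≡-mod-refl {a = c})

  ≡-mod-∣ : ∀ {D M a b} → D ℤS.∣ M → a ≡ b ⟨mod M ⟩ → a ≡ b ⟨mod D ⟩
  ≡-mod-∣ {D} {b = b} (ℤS.divides q refl) (mod-by k refl) = mod-by (k * q) (solve (b ∷ k ∷ q ∷ D ∷ []))

  ≡-mod-1 : ∀ {a b} → a ≡ b ⟨mod + 1 ⟩
  ≡-mod-1 {a} {b} = mod-by (a - b) (solve (a ∷ b ∷ []))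

  1≡0-mod⇒≡1 : ∀ {m} → + 1 ≡ + 0 ⟨mod + m ⟩ → m ≡ 1
  1≡0-mod⇒≡1 1≡0 = ℕD.∣1⇒≡1 (to-[mod] 1≡0)

  ∣⇒≡0-mod : ∀ {m a} → m ℕD.∣ ∣ a ∣ → a ≡ + 0 ⟨mod + m ⟩
  ∣⇒≡0-mod {m} {a} m∣a = from-[mod] (subst (λ x → m ℕD.∣ ∣ x ∣) (sym (ℤ.+-identityʳ a)) m∣a)

  ≡0-mod⇒∣ : ∀ {m a} → a ≡ + 0 ⟨mod + m ⟩ → m ℕD.∣ ∣ a ∣
  ≡0-mod⇒∣ {m} {a} a≡0 = subst (λ x → m ℕD.∣ ∣ x ∣) (ℤ.+-identityʳ a) (to-[mod] a≡0)

  ≡-mod-crt : ∀ {A B e x u v} → e ≡ + 1 ⟨mod A ⟩ → e ≡ + 0 ⟨mod B ⟩ →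
              x ≡ u ⟨mod A ⟩ → x ≡ v ⟨mod B ⟩ → x ≡ e * u + (+ 1 - e) * v ⟨mod A * B ⟩
  ≡-mod-crt {A} {B} {u = u} {v} (mod-by k e≡1) (mod-by l refl) (mod-by s refl) (mod-by t x≡v) =
    mod-by (l * s - k * t) (begin
      u + s * A
        ≡⟨ split u v s t k l A B ⟩
      e * u + (+ 1 - e) * v + (l * s - k * t) * (A * B)
        + (+ 1 - e) * ((u + s * A) - (v + t * B)) - t * B * (e - (+ 1 + k * A))
        ≡⟨ cong₂ (λ z w → e * u + (+ 1 - e) * v + (l * s - k * t) * (A * B) + (+ 1 - e) * z - t * B * w)
                 (ℤ.i≡j⇒i-j≡0 x≡v) (ℤ.i≡j⇒i-j≡0 e≡1) ⟩
      e * u + (+ 1 - e) * v + (l * s - k * t) * (A * B) + (+ 1 - e) * + 0 - t * B * + 0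
        ≡⟨ drop-zeros (e * u + (+ 1 - e) * v + (l * s - k * t) * (A * B)) (+ 1 - e) (t * B) ⟩
      e * u + (+ 1 - e) * v + (l * s - k * t) * (A * B) ∎)
    where
    open ≡-Reasoning
    e = + 0 + l * B
    -- x − (e u + (1 − e) v) = e (x − u) + (1 − e) (x − v), rewritten so that the two
    -- hypotheses appear as differences that vanish.
    split : ∀ u v s t k l A B → u + s * A ≡
      (+ 0 + l * B) * u + (+ 1 - (+ 0 + l * B)) * v + (l * s - k * t) * (A * B)
        + (+ 1 - (+ 0 + l * B)) * ((u + s * A) - (v + t * B)) - t * B * ((+ 0 + l * B) - (+ 1 + k * A))
    split = solve-∀
    drop-zeros : ∀ x y z → x + y * + 0 - z * + 0 ≡ x
    drop-zeros = solve-∀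

  private
    pos-1+*≡* : ∀ x y a b → 1 ℕ.+ y ℕ.* b ≡ x ℕ.* a → + 1 + + y * + b ≡ + x * + a
    pos-1+*≡* x y a b eq = begin
      + 1 + + y * + b    ≡⟨ cong (λ z → + 1 + z) (ℤ.pos-* y b) ⟨
      + (1 ℕ.+ y ℕ.* b)  ≡⟨ cong +_ eq ⟩
      + (x ℕ.* a)        ≡⟨ ℤ.pos-* x a ⟩
      + x * + a          ∎
      where open ≡-Reasoning

    yb≡0+yb : ∀ y b → y * b ≡ + 0 + y * b
    yb≡0+yb y b = solve (y ∷ b ∷ [])

  crt-idempotent : ∀ {a b} → Coprime a b → ∃[ e ] (e ≡ + 1 ⟨mod + a ⟩ × e ≡ + 0 ⟨mod + b ⟩)
  crt-idempotent {a} {b} cop with coprime-Bézout cop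
  ... | Bézout.+- x y eq =
    - + y * + b , mod-by (- + x) (-yb≡1-xa (+ x) (+ y) (+ a) (+ b) (pos-1+*≡* x y a b eq)) , mod-by (- + y) (yb≡0+yb (- + y) (+ b))
    where
    -yb≡1-xa : ∀ x y a b → + 1 + y * b ≡ x * a → - y * b ≡ + 1 + - x * a
    -yb≡1-xa x y a b 1+yb≡xa = begin
      - y * b              ≡⟨ solve (y ∷ b ∷ []) ⟩
      + 1 - (+ 1 + y * b)  ≡⟨ cong (λ z → + 1 - z) 1+yb≡xa ⟩
      + 1 - x * a          ≡⟨ solve (x ∷ a ∷ []) ⟩
      + 1 + - x * a        ∎
      where open ≡-Reasoning
  ... | Bézout.-+ x y eq = + y * + b , mod-by (+ x) (sym (pos-1+*≡* y x b a eq)) , mod-by (+ y) (yb≡0+yb (+ y) (+ b))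

  coprime⇒unit-mod : ∀ {n} D → Coprime n ∣ D ∣ → UnitMod n D
  coprime⇒unit-mod {n} D cop with crt-idempotent cop | ℤS.m∣∣m∣ {D}
  ... | _ , e≡1 , mod-by l refl | ℤS.divides q ∣D∣≡qD = l * q , to-[mod] (≡-mod-trans (≡-mod-reflexive D*lq≡e) e≡1)
    where
    D*lq≡e : D * (l * q) ≡ + 0 + l * + ∣ D ∣
    D*lq≡e = begin
      D * (l * q)        ≡⟨ solve (D ∷ l ∷ q ∷ []) ⟩
      + 0 + l * (q * D)  ≡⟨ cong (λ z → + 0 + l * z) ∣D∣≡qD ⟨
      + 0 + l * + ∣ D ∣  ∎
      where open ≡-Reasoning

module Polynomial where

  open Congruence

  open import Data.Integer using (_+_; _-_; _*_)
  open import Relation.Binary.Definitions using (tri<; tri≈; tri>)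

  infix 4 _≈_⟨modP_⟩

  record _≈_⟨modP_⟩ (p q : Poly) (M : ℤ) : Set where
    constructor coeffwise
    field
      at : ∀ k → coeff p k ≡ coeff q k ⟨mod M ⟩
  open _≈_⟨modP_⟩ public

  module _ {M : ℤ} where

    ≈P-refl : ∀ {p} → p ≈ p ⟨modP M ⟩
    ≈P-refl = coeffwise λ _ → ≡-mod-refl

    ≈P-sym : ∀ {p q} → p ≈ q ⟨modP M ⟩ → q ≈ p ⟨modP M ⟩
    ≈P-sym p≈q = coeffwise λ k → ≡-mod-sym (at p≈q k)

    ≈P-trans : ∀ {p q r} → p ≈ q ⟨modP M ⟩ → q ≈ r ⟨modP M ⟩ → p ≈ r ⟨modP M ⟩
    ≈P-trans p≈q q≈r = coeffwise λ k → ≡-mod-trans (at p≈q k) (at q≈r k)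

    ≗⇒≈P : ∀ {p q} → coeff p ≗ coeff q → p ≈ q ⟨modP M ⟩
    ≗⇒≈P p≗q = coeffwise λ k → ≡-mod-reflexive (p≗q k)

  ≈P-setoid : ℤ → Setoid 0ℓ 0ℓ
  ≈P-setoid M = record
    { Carrier       = Poly
    ; _≈_           = _≈_⟨modP M ⟩
    ; isEquivalence = record { refl = ≈P-refl ; sym = ≈P-sym ; trans = ≈P-trans } }

  from-[modP] : ∀ {m} p q → p ≈ q [modP m ] → p ≈ q ⟨modP + m ⟩
  from-[modP] p q p≈q = coeffwise λ k → from-[mod] {a = coeff p k} {coeff q k} (p≈q k)

  to-[modP] : ∀ {m} p q → p ≈ q ⟨modP + m ⟩ → p ≈ q [modP m ]
  to-[modP] p q p≈q k = to-[mod] (at p≈q k)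

  ≈P-∣ : ∀ {D M p q} → D ℤS.∣ M → p ≈ q ⟨modP M ⟩ → p ≈ q ⟨modP D ⟩
  ≈P-∣ D∣M p≈q = coeffwise λ k → ≡-mod-∣ D∣M (at p≈q k)

  coeff-⊕ : ∀ p q k → coeff (p ⊕ q) k ≡ coeff p k + coeff q k
  coeff-⊕ []      q       k       = sym (ℤ.+-identityˡ (coeff q k))
  coeff-⊕ (a ∷ p) []      k       = sym (ℤ.+-identityʳ (coeff (a ∷ p) k))
  coeff-⊕ (a ∷ p) (b ∷ q) zero    = refl
  coeff-⊕ (a ∷ p) (b ∷ q) (suc k) = coeff-⊕ p q k

  coeff-· : ∀ e p k → coeff (e · p) k ≡ e * coeff p k
  coeff-· e []      k       = sym (ℤ.*-zeroʳ e)
  coeff-· e (a ∷ p) zero    = refl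
  coeff-· e (a ∷ p) (suc k) = coeff-· e p k

  conv : (ℕ → ℤ) → (ℕ → ℤ) → ℕ → ℤ
  conv f g zero    = f 0 * g 0
  conv f g (suc k) = f 0 * g (suc k) + conv (f ∘ suc) g k

  conv-zeroˡ : ∀ g k → conv (λ _ → + 0) g k ≡ + 0
  conv-zeroˡ g zero    = refl
  conv-zeroˡ g (suc k) = trans (ℤ.+-identityˡ _) (conv-zeroˡ g k)

  conv-identityˡ : ∀ g k → conv (coeff oneP) g k ≡ g k
  conv-identityˡ g zero    = ℤ.*-identityˡ (g 0)
  conv-identityˡ g (suc k) = trans (cong₂ _+_ (ℤ.*-identityˡ (g (suc k))) (conv-zeroˡ g k)) (ℤ.+-identityʳ (g (suc k)))

  conv-identityʳ : ∀ f k → conv f (coeff oneP) k ≡ f k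
  conv-identityʳ f zero    = ℤ.*-identityʳ (f 0)
  conv-identityʳ f (suc k) = trans (cong₂ _+_ (ℤ.*-zeroʳ (f 0)) (conv-identityʳ (f ∘ suc) k)) (ℤ.+-identityˡ (f (suc k)))

  coeff-⊗ : ∀ p q → coeff (p ⊗ q) ≗ conv (coeff p) (coeff q)
  coeff-⊗ []      q k       = sym (conv-zeroˡ (coeff q) k)
  coeff-⊗ (a ∷ p) q zero    = trans (coeff-⊕ (a · q) (+ 0 ∷ p ⊗ q) 0)
                                    (trans (ℤ.+-identityʳ _) (coeff-· a q 0))
  coeff-⊗ (a ∷ p) q (suc k) = trans (coeff-⊕ (a · q) (+ 0 ∷ p ⊗ q) (suc k))
                                    (cong₂ _+_ (coeff-· a q (suc k)) (coeff-⊗ p q k))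

  conv-cong : ∀ {M f f' g g'} → (∀ i → f i ≡ f' i ⟨mod M ⟩) → (∀ j → g j ≡ g' j ⟨mod M ⟩) →
              ∀ k → conv f g k ≡ conv f' g' k ⟨mod M ⟩
  conv-cong f≡f' g≡g' zero    = *-cong-mod (f≡f' 0) (g≡g' 0)
  conv-cong f≡f' g≡g' (suc k) = +-cong-mod (*-cong-mod (f≡f' 0) (g≡g' (suc k))) (conv-cong (f≡f' ∘ suc) g≡g' k)

  ⊗-identityˡ : ∀ p → coeff (oneP ⊗ p) ≗ coeff p
  ⊗-identityˡ p k = trans (coeff-⊗ oneP p k) (conv-identityˡ (coeff p) k)

  ⊗-identityʳ : ∀ p → coeff (p ⊗ oneP) ≗ coeff p
  ⊗-identityʳ p k = trans (coeff-⊗ p oneP k) (conv-identityʳ (coeff p) k)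

  module _ {M : ℤ} where

    ⊕-cong : ∀ {p p' q q'} → p ≈ p' ⟨modP M ⟩ → q ≈ q' ⟨modP M ⟩ → p ⊕ q ≈ p' ⊕ q' ⟨modP M ⟩
    ⊕-cong {p} {p'} {q} {q'} p≈p' q≈q' = coeffwise λ k →
      ≡-mod-resp (coeff-⊕ p q k) (coeff-⊕ p' q' k) (+-cong-mod (at p≈p' k) (at q≈q' k))

    ⊗-cong : ∀ {p p' q q'} → p ≈ p' ⟨modP M ⟩ → q ≈ q' ⟨modP M ⟩ → p ⊗ q ≈ p' ⊗ q' ⟨modP M ⟩
    ⊗-cong {p} {p'} {q} {q'} p≈p' q≈q' = coeffwise λ k →
      ≡-mod-resp (coeff-⊗ p q k) (coeff-⊗ p' q' k) (conv-cong (at p≈p') (at q≈q') k)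

  combine : ℤ → Poly → Poly → Poly
  combine e p q = e · p ⊕ (+ 1 - e) · q

  coeff-combine : ∀ e p q k → coeff (combine e p q) k ≡ e * coeff p k + (+ 1 - e) * coeff q k
  coeff-combine e p q k = trans (coeff-⊕ (e · p) ((+ 1 - e) · q) k) (cong₂ _+_ (coeff-· e p k) (coeff-· (+ 1 - e) q k))

  conv-linearʳ : ∀ {G g h} e e' → (∀ j → G j ≡ e * g j + e' * h j) →
                 ∀ f k → conv f G k ≡ e * conv f g k + e' * conv f h k
  conv-linearʳ e e' G≡ f zero    = trans (cong (f 0 *_) (G≡ 0)) (distrib (f 0) _ _ e e')
    where
    distrib : ∀ x y z e e' → x * (e * y + e' * z) ≡ e * (x * y) + e' * (x * z)
    distrib = solve-∀
  conv-linearʳ e e' G≡ f (suc k) =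
    trans (cong₂ _+_ (cong (f 0 *_) (G≡ (suc k))) (conv-linearʳ e e' G≡ (f ∘ suc) k)) (distrib (f 0) _ _ _ _ e e')
    where
    distrib : ∀ x y z C D e e' → x * (e * y + e' * z) + (e * C + e' * D) ≡ e * (x * y + C) + e' * (x * z + D)
    distrib = solve-∀

  conv-linearˡ : ∀ {F f g} e e' → (∀ i → F i ≡ e * f i + e' * g i) →
                 ∀ h k → conv F h k ≡ e * conv f h k + e' * conv g h k
  conv-linearˡ e e' F≡ h zero    = trans (cong (_* h 0) (F≡ 0)) (distrib (h 0) _ _ e e')
    where
    distrib : ∀ x y z e e' → (e * y + e' * z) * x ≡ e * (y * x) + e' * (z * x)
    distrib = solve-∀
  conv-linearˡ e e' F≡ h (suc k) =
    trans (cong₂ _+_ (cong (_* h (suc k)) (F≡ 0)) (conv-linearˡ e e' (F≡ ∘ suc) h k)) (distrib (h (suc k)) _ _ _ _ e e')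
    where
    distrib : ∀ x y z C D e e' → (e * y + e' * z) * x + (e * C + e' * D) ≡ e * (y * x + C) + e' * (z * x + D)
    distrib = solve-∀

  ⊗-combineʳ : ∀ {M} e h q₁ q₂ → h ⊗ combine e q₁ q₂ ≈ combine e (h ⊗ q₁) (h ⊗ q₂) ⟨modP M ⟩
  ⊗-combineʳ e h q₁ q₂ = ≗⇒≈P λ k → begin
    coeff (h ⊗ combine e q₁ q₂) k                                ≡⟨ coeff-⊗ h _ k ⟩
    conv (coeff h) (coeff (combine e q₁ q₂)) k                   ≡⟨ conv-linearʳ e (+ 1 - e) (coeff-combine e q₁ q₂) (coeff h) k ⟩
    e * conv (coeff h) (coeff q₁) k + (+ 1 - e) * conv (coeff h) (coeff q₂) k
      ≡⟨ cong₂ (λ x y → e * x + (+ 1 - e) * y) (coeff-⊗ h q₁ k) (coeff-⊗ h q₂ k) ⟨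
    e * coeff (h ⊗ q₁) k + (+ 1 - e) * coeff (h ⊗ q₂) k          ≡⟨ coeff-combine e (h ⊗ q₁) (h ⊗ q₂) k ⟨
    coeff (combine e (h ⊗ q₁) (h ⊗ q₂)) k                        ∎
    where open ≡-Reasoning

  ⊗-combineˡ : ∀ {M} e p₁ p₂ g → combine e p₁ p₂ ⊗ g ≈ combine e (p₁ ⊗ g) (p₂ ⊗ g) ⟨modP M ⟩
  ⊗-combineˡ e p₁ p₂ g = ≗⇒≈P λ k → begin
    coeff (combine e p₁ p₂ ⊗ g) k                                ≡⟨ coeff-⊗ (combine e p₁ p₂) g k ⟩
    conv (coeff (combine e p₁ p₂)) (coeff g) k                   ≡⟨ conv-linearˡ e (+ 1 - e) (coeff-combine e p₁ p₂) (coeff g) k ⟩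
    e * conv (coeff p₁) (coeff g) k + (+ 1 - e) * conv (coeff p₂) (coeff g) k
      ≡⟨ cong₂ (λ x y → e * x + (+ 1 - e) * y) (coeff-⊗ p₁ g k) (coeff-⊗ p₂ g k) ⟨
    e * coeff (p₁ ⊗ g) k + (+ 1 - e) * coeff (p₂ ⊗ g) k          ≡⟨ coeff-combine e (p₁ ⊗ g) (p₂ ⊗ g) k ⟨
    coeff (combine e (p₁ ⊗ g) (p₂ ⊗ g)) k                        ∎
    where open ≡-Reasoning

  combine-⊕ : ∀ {M} e p q p' q' → combine e p q ⊕ combine e p' q' ≈ combine e (p ⊕ p') (q ⊕ q') ⟨modP M ⟩
  combine-⊕ e p q p' q' = ≗⇒≈P λ k → begin
    coeff (combine e p q ⊕ combine e p' q') k
      ≡⟨ trans (coeff-⊕ (combine e p q) _ k) (cong₂ _+_ (coeff-combine e p q k) (coeff-combine e p' q' k)) ⟩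
    (e * coeff p k + (+ 1 - e) * coeff q k) + (e * coeff p' k + (+ 1 - e) * coeff q' k)
      ≡⟨ regroup e (coeff p k) (coeff q k) (coeff p' k) (coeff q' k) ⟩
    e * (coeff p k + coeff p' k) + (+ 1 - e) * (coeff q k + coeff q' k)
      ≡⟨ trans (coeff-combine e (p ⊕ p') (q ⊕ q') k) (cong₂ (λ x y → e * x + (+ 1 - e) * y) (coeff-⊕ p p' k) (coeff-⊕ q q' k)) ⟨
    coeff (combine e (p ⊕ p') (q ⊕ q')) k ∎
    where
    open ≡-Reasoning
    regroup : ∀ e x y x' y' → (e * x + (+ 1 - e) * y) + (e * x' + (+ 1 - e) * y') ≡ e * (x + x') + (+ 1 - e) * (y + y')
    regroup = solve-∀

  ≈P-crt : ∀ {A B e P Q₁ Q₂} → e ≡ + 1 ⟨mod A ⟩ → e ≡ + 0 ⟨mod B ⟩ →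
           P ≈ Q₁ ⟨modP A ⟩ → P ≈ Q₂ ⟨modP B ⟩ → P ≈ combine e Q₁ Q₂ ⟨modP A * B ⟩
  ≈P-crt {e = e} {Q₁ = Q₁} {Q₂} e≡1 e≡0 P≈Q₁ P≈Q₂ = coeffwise λ k →
    ≡-mod-resp refl (coeff-combine e Q₁ Q₂ k) (≡-mod-crt e≡1 e≡0 (at P≈Q₁ k) (at P≈Q₂ k))

  record MonicOfDegree (M : ℤ) (f : ℕ → ℤ) (d : ℕ) : Set where
    constructor monic
    field
      leading   : f d ≡ + 1 ⟨mod M ⟩
      vanishing : ∀ k → d < k → f k ≡ + 0 ⟨mod M ⟩
  open MonicOfDegree public

  from-MonicDeg : ∀ {m} p {d} → MonicDeg m p d → MonicOfDegree (+ m) (coeff p) d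
  from-MonicDeg p {d} (lead , van) =
    monic (from-[mod] {a = coeff p d} lead) (λ k d<k → from-[mod] {a = coeff p k} (van k d<k))

  to-MonicDeg : ∀ {m} p {d} → MonicOfDegree (+ m) (coeff p) d → MonicDeg m p d
  to-MonicDeg p (monic lead van) = to-[mod] lead , λ k d<k → to-[mod] (van k d<k)

  module _ {M : ℤ} where

    MonicOfDegree-cong : ∀ {f g d} → (∀ k → f k ≡ g k ⟨mod M ⟩) → MonicOfDegree M f d → MonicOfDegree M g d
    MonicOfDegree-cong f≡g (monic lead van) =
      monic (≡-mod-trans (≡-mod-sym (f≡g _)) lead) (λ k d<k → ≡-mod-trans (≡-mod-sym (f≡g k)) (van k d<k))

    MonicOfDegree-conv : ∀ {f g d₁ d} → MonicOfDegree M f d₁ → MonicOfDegree M g d → MonicOfDegree M (conv f g) (d₁ ℕ.+ d)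
    MonicOfDegree-conv {f} {g} {zero} f-monic g-monic = MonicOfDegree-cong g≡conv g-monic
      where
      f≈1 : ∀ k → f k ≡ coeff oneP k ⟨mod M ⟩
      f≈1 zero    = leading f-monic
      f≈1 (suc k) = vanishing f-monic (suc k) (s≤s z≤n)
      g≡conv : ∀ k → g k ≡ conv f g k ⟨mod M ⟩
      g≡conv k = ≡-mod-sym (≡-mod-trans (conv-cong f≈1 (λ _ → ≡-mod-refl) k) (≡-mod-reflexive (conv-identityˡ g k)))
    MonicOfDegree-conv {f} {g} {suc d₁} {d} (monic lead van) g-monic = monic top above
      where
      tail-monic : MonicOfDegree M (conv (f ∘ suc) g) (d₁ ℕ.+ d)
      tail-monic = MonicOfDegree-conv (monic lead (λ k d₁<k → van (suc k) (s≤s d₁<k))) g-monic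
      absorb : ∀ x y → x * + 0 + y ≡ y
      absorb = solve-∀
      top : conv f g (suc (d₁ ℕ.+ d)) ≡ + 1 ⟨mod M ⟩
      top = ≡-mod-trans (+-cong-mod (*-congˡ-mod (f 0) (vanishing g-monic _ (s≤s (ℕ.m≤n+m d d₁)))) (leading tail-monic))
                        (≡-mod-reflexive (absorb (f 0) (+ 1)))
      above : ∀ k → suc (d₁ ℕ.+ d) < k → conv f g k ≡ + 0 ⟨mod M ⟩
      above (suc k) (s≤s d₁+d<k) =
        ≡-mod-trans (+-cong-mod (*-congˡ-mod (f 0) (vanishing g-monic _ (s≤s (ℕ.≤-trans (ℕ.m≤n+m d d₁) (ℕ.<⇒≤ d₁+d<k)))))
                                (vanishing tail-monic k d₁+d<k))
                    (≡-mod-reflexive (absorb (f 0) (+ 0)))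

    MonicOfDegree-⊗ : ∀ {p q d₁ d} → MonicOfDegree M (coeff p) d₁ → MonicOfDegree M (coeff q) d →
                      MonicOfDegree M (coeff (p ⊗ q)) (d₁ ℕ.+ d)
    MonicOfDegree-⊗ {p} {q} p-monic q-monic =
      MonicOfDegree-cong (λ k → ≡-mod-reflexive (sym (coeff-⊗ p q k))) (MonicOfDegree-conv p-monic q-monic)

    MonicOfDegree-∣ : ∀ {D f d} → D ℤS.∣ M → MonicOfDegree M f d → MonicOfDegree D f d
    MonicOfDegree-∣ D∣M (monic lead van) = monic (≡-mod-∣ D∣M lead) (λ k d<k → ≡-mod-∣ D∣M (van k d<k))

    degree-0⇒≈oneP : ∀ {p} → MonicOfDegree M (coeff p) 0 → p ≈ oneP ⟨modP M ⟩
    degree-0⇒≈oneP p-monic = coeffwise λ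
      { zero    → leading p-monic
      ; (suc k) → vanishing p-monic (suc k) (s≤s z≤n) }

    oneP-monic : MonicOfDegree M (coeff oneP) 0
    oneP-monic = monic ≡-mod-refl λ { (suc k) _ → ≡-mod-refl }

    fPoly-monic : ∀ b c → MonicOfDegree M (coeff (fPoly b c)) 2
    fPoly-monic b c = monic ≡-mod-refl λ
      { (suc (suc (suc k))) _ → ≡-mod-refl
      ; (suc zero) (s≤s ())
      ; (suc (suc zero)) (s≤s (s≤s ())) }

  MonicOfDegree-unique : ∀ {m f d d'} → 1 < m → MonicOfDegree (+ m) f d → MonicOfDegree (+ m) f d' → d ≡ d'
  MonicOfDegree-unique {d = d} {d'} 1<m f-monic f-monic' with ℕ.<-cmp d d'
  ... | tri< d<d' _ _ = contradiction (1≡0-mod⇒≡1 (≡-mod-trans (≡-mod-sym (leading f-monic')) (vanishing f-monic d' d<d'))) (ℕ.>⇒≢ 1<m)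
  ... | tri≈ _ d≡d' _ = d≡d'
  ... | tri> _ _ d'<d = contradiction (1≡0-mod⇒≡1 (≡-mod-trans (≡-mod-sym (leading f-monic)) (vanishing f-monic' d d'<d))) (ℕ.>⇒≢ 1<m)

module CommonDivisor where

  open Congruence
  open Polynomial


  private
    ≈P-∣ℕ : ∀ {d m} p q → d ℕD.∣ m → p ≈ q [modP m ] → p ≈ q [modP d ]
    ≈P-∣ℕ p q d∣m p≈q = to-[modP] p q (≈P-∣ (ℤS.∣ᵤ⇒∣ d∣m) (from-[modP] p q p≈q))

    ≈P-crtℕ : ∀ {a b e} P Q₁ Q₂ → e ≡ + 1 ⟨mod + a ⟩ → e ≡ + 0 ⟨mod + b ⟩ →
              P ≈ Q₁ [modP a ] → P ≈ Q₂ [modP b ] → P ≈ combine e Q₁ Q₂ ⟨modP + (a ℕ.* b) ⟩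
    ≈P-crtℕ {a} {b} P Q₁ Q₂ e≡1 e≡0 P≈Q₁ P≈Q₂ =
      subst (P ≈ combine _ Q₁ Q₂ ⟨modP_⟩) (sym (ℤ.pos-* a b)) (≈P-crt e≡1 e≡0 (from-[modP] P Q₁ P≈Q₁) (from-[modP] P Q₂ P≈Q₂))

    ≈P-1 : ∀ p q → p ≈ q [modP 1 ]
    ≈P-1 p q = to-[modP] p q (coeffwise λ _ → ≡-mod-1)

  Monic-∣ : ∀ {d m} p → d ℕD.∣ m → Monic m p → Monic d p
  Monic-∣ p d∣m (deg , p-monic) = deg , to-MonicDeg p (MonicOfDegree-∣ (ℤS.∣ᵤ⇒∣ d∣m) (from-MonicDeg p p-monic))

  Gcmd-∣ : ∀ {d m} g₁ g₂ h → d ℕD.∣ m → Gcmd m g₁ g₂ h → Gcmd d g₁ g₂ h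
  Gcmd-∣ g₁ g₂ h d∣m (h-monic , (a , b , h≈) , (q₁ , g₁≈) , (q₂ , g₂≈)) =
    Monic-∣ h d∣m h-monic ,
    (a , b , ≈P-∣ℕ h (a ⊗ g₁ ⊕ b ⊗ g₂) d∣m h≈) ,
    (q₁ , ≈P-∣ℕ g₁ (h ⊗ q₁) d∣m g₁≈) , (q₂ , ≈P-∣ℕ g₂ (h ⊗ q₂) d∣m g₂≈)

  Gcmd-cong : ∀ {m g₂' h'} g₁ g₂ h → g₂ ≈ g₂' ⟨modP + m ⟩ → h ≈ h' ⟨modP + m ⟩ → Gcmd m g₁ g₂ h → Gcmd m g₁ g₂' h'
  Gcmd-cong {m} {g₂'} {h'} g₁ g₂ h g₂≈g₂' h≈h' ((d , h-monic) , (a , b , h≈) , (q₁ , g₁≈) , (q₂ , g₂≈)) =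
    (d , to-MonicDeg h' (MonicOfDegree-cong (at h≈h') (from-MonicDeg h h-monic))) ,
    (a , b , to-[modP] h' (a ⊗ g₁ ⊕ b ⊗ g₂') (begin
      h'                 ≈⟨ h≈h' ⟨
      h                  ≈⟨ from-[modP] h (a ⊗ g₁ ⊕ b ⊗ g₂) h≈ ⟩
      a ⊗ g₁ ⊕ b ⊗ g₂    ≈⟨ ⊕-cong (≈P-refl {p = a ⊗ g₁}) (⊗-cong (≈P-refl {p = b}) g₂≈g₂') ⟩
      a ⊗ g₁ ⊕ b ⊗ g₂'   ∎)) ,
    (q₁ , to-[modP] g₁ (h' ⊗ q₁) (≈P-trans (from-[modP] g₁ (h ⊗ q₁) g₁≈) (⊗-cong h≈h' ≈P-refl))) ,
    (q₂ , to-[modP] g₂' (h' ⊗ q₂) (begin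
      g₂'                ≈⟨ g₂≈g₂' ⟨
      g₂                 ≈⟨ from-[modP] g₂ (h ⊗ q₂) g₂≈ ⟩
      h ⊗ q₂             ≈⟨ ⊗-cong h≈h' ≈P-refl ⟩
      h' ⊗ q₂            ∎))
    where open SetoidReasoning (≈P-setoid (+ m))

  DividesP-1 : ∀ h g → DividesP 1 h g
  DividesP-1 h g = [] , ≈P-1 g (h ⊗ [])

  Gcmd-1 : ∀ g₁ g₂ h → Monic 1 h → Gcmd 1 g₁ g₂ h
  Gcmd-1 g₁ g₂ h h-monic = h-monic , ([] , [] , ≈P-1 h ([] ⊗ g₁ ⊕ [] ⊗ g₂)) , DividesP-1 h g₁ , DividesP-1 h g₂

  DividesP-crt : ∀ {a b} h g → Coprime a b → DividesP a h g → DividesP b h g → DividesP (a ℕ.* b) h g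
  DividesP-crt {a} {b} h g cop (q₁ , g≈₁) (q₂ , g≈₂) with crt-idempotent cop
  ... | e , e≡1 , e≡0 = combine e q₁ q₂ , to-[modP] g (h ⊗ combine e q₁ q₂) (begin
    g                                  ≈⟨ ≈P-crtℕ g (h ⊗ q₁) (h ⊗ q₂) e≡1 e≡0 g≈₁ g≈₂ ⟩
    combine e (h ⊗ q₁) (h ⊗ q₂)        ≈⟨ ⊗-combineʳ e h q₁ q₂ ⟨
    h ⊗ combine e q₁ q₂                ∎)
    where open SetoidReasoning (≈P-setoid (+ (a ℕ.* b)))

  InIdeal₂-crt : ∀ {a b} g₁ g₂ h → Coprime a b → InIdeal₂ a g₁ g₂ h → InIdeal₂ b g₁ g₂ h → InIdeal₂ (a ℕ.* b) g₁ g₂ h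
  InIdeal₂-crt {a} {b} g₁ g₂ h cop (a₁ , b₁ , h≈₁) (a₂ , b₂ , h≈₂) with crt-idempotent cop
  ... | e , e≡1 , e≡0 = combine e a₁ a₂ , combine e b₁ b₂ , to-[modP] h (combine e a₁ a₂ ⊗ g₁ ⊕ combine e b₁ b₂ ⊗ g₂) (begin
    h                                                               ≈⟨ ≈P-crtℕ h (a₁ ⊗ g₁ ⊕ b₁ ⊗ g₂) (a₂ ⊗ g₁ ⊕ b₂ ⊗ g₂) e≡1 e≡0 h≈₁ h≈₂ ⟩
    combine e (a₁ ⊗ g₁ ⊕ b₁ ⊗ g₂) (a₂ ⊗ g₁ ⊕ b₂ ⊗ g₂)               ≈⟨ combine-⊕ e (a₁ ⊗ g₁) (a₂ ⊗ g₁) (b₁ ⊗ g₂) (b₂ ⊗ g₂) ⟨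
    combine e (a₁ ⊗ g₁) (a₂ ⊗ g₁) ⊕ combine e (b₁ ⊗ g₂) (b₂ ⊗ g₂)   ≈⟨ ⊕-cong (⊗-combineˡ e a₁ a₂ g₁) (⊗-combineˡ e b₁ b₂ g₂) ⟨
    combine e a₁ a₂ ⊗ g₁ ⊕ combine e b₁ b₂ ⊗ g₂                     ∎)
    where open SetoidReasoning (≈P-setoid (+ (a ℕ.* b)))

  Gcmd-crt : ∀ {a b} g₁ g₂ h → Coprime a b → Monic (a ℕ.* b) h → Gcmd a g₁ g₂ h → Gcmd b g₁ g₂ h → Gcmd (a ℕ.* b) g₁ g₂ h
  Gcmd-crt g₁ g₂ h cop h-monic (_ , ideal₁ , div₁ , div₁') (_ , ideal₂ , div₂ , div₂') =
    h-monic , InIdeal₂-crt g₁ g₂ h cop ideal₁ ideal₂ , DividesP-crt h g₁ cop div₁ div₂ , DividesP-crt h g₂ cop div₁' div₂'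

module QuadraticExtension where

  open Congruence
  open Polynomial

  open import Data.Integer using (_+_; _-_; _*_)
  open import Algebra.Bundles using (CommutativeSemiring)
  open import Algebra.Structures {A = QR} _≡_ using (IsCommutativeMonoid)
  open import Algebra.Structures.Biased {A = QR} _≡_ using (isCommutativeMonoidˡ; isCommutativeSemiringˡ)

  infix 4 _≈ᴿ_⟨mod_⟩

  record _≈ᴿ_⟨mod_⟩ (X Y : QR) (M : ℤ) : Set where
    constructor componentwise
    field
      fst : proj₁ X ≡ proj₁ Y ⟨mod M ⟩
      snd : proj₂ X ≡ proj₂ Y ⟨mod M ⟩
  open _≈ᴿ_⟨mod_⟩

  module _ {M : ℤ} where

    ≈ᴿ-refl : ∀ {X} → X ≈ᴿ X ⟨mod M ⟩
    ≈ᴿ-refl = componentwise ≡-mod-refl ≡-mod-refl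

    ≈ᴿ-reflexive : ∀ {X Y} → X ≡ Y → X ≈ᴿ Y ⟨mod M ⟩
    ≈ᴿ-reflexive refl = ≈ᴿ-refl

    ≈ᴿ-sym : ∀ {X Y} → X ≈ᴿ Y ⟨mod M ⟩ → Y ≈ᴿ X ⟨mod M ⟩
    ≈ᴿ-sym (componentwise u v) = componentwise (≡-mod-sym u) (≡-mod-sym v)

    ≈ᴿ-trans : ∀ {X Y Z} → X ≈ᴿ Y ⟨mod M ⟩ → Y ≈ᴿ Z ⟨mod M ⟩ → X ≈ᴿ Z ⟨mod M ⟩
    ≈ᴿ-trans (componentwise u v) (componentwise u' v') = componentwise (≡-mod-trans u u') (≡-mod-trans v v')

  ≈ᴿ-setoid : ℤ → Setoid 0ℓ 0ℓ
  ≈ᴿ-setoid M = record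
    { Carrier       = QR
    ; _≈_           = _≈ᴿ_⟨mod M ⟩
    ; isEquivalence = record { refl = ≈ᴿ-refl ; sym = ≈ᴿ-sym ; trans = ≈ᴿ-trans } }

  pattern ι a = (a , + 0)
  pattern y   = (+ 0 , + 1)

  -- Coordinatewise identities behind the ring laws of QR, where mulR b c multiplies
  -- u + v y by x + x' y using y² = - b y - c, and behind f(y) = 0.
  private
    *ᴿ-assoc₁ : ∀ b c u v x x' z z' → (u * x - c * (v * x')) * z - c * ((u * x' + x * v - b * (v * x')) * z')
                                     ≡ u * (x * z - c * (x' * z')) - c * (v * (x * z' + z * x' - b * (x' * z')))
    *ᴿ-assoc₁ = solve-∀

    *ᴿ-assoc₂ : ∀ b c u v x x' z z' →
      (u * x - c * (v * x')) * z' + z * (u * x' + x * v - b * (v * x')) - b * ((u * x' + x * v - b * (v * x')) * z')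
      ≡ u * (x * z' + z * x' - b * (x' * z')) + (x * z - c * (x' * z')) * v - b * (v * (x * z' + z * x' - b * (x' * z')))
    *ᴿ-assoc₂ = solve-∀

    *ᴿ-distribʳ₁ : ∀ b c u v x x' z z' → (x + z) * u - c * ((x' + z') * v) ≡ (x * u - c * (x' * v)) + (z * u - c * (z' * v))
    *ᴿ-distribʳ₁ = solve-∀

    *ᴿ-distribʳ₂ : ∀ b c u v x x' z z' →
      (x + z) * v + u * (x' + z') - b * ((x' + z') * v) ≡ (x * v + u * x' - b * (x' * v)) + (z * v + u * z' - b * (z' * v))
    *ᴿ-distribʳ₂ = solve-∀

    y-root₁ : ∀ b c → + 0 * + 0 - c * (+ 1 * + 1) + (b * + 0 - c * (+ 0 * + 1)) + c ≡ + 0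
    y-root₁ = solve-∀

    y-root₂ : ∀ b c → + 0 * + 1 + + 0 * + 1 - b * (+ 1 * + 1) + (b * + 1 + + 0 * + 0 - b * (+ 0 * + 1)) + + 0 ≡ + 0
    y-root₂ = solve-∀

  module _ (b c : ℤ) where

    infixl 6 _+ᴿ_
    infixl 7 _*ᴿ_

    _+ᴿ_ : QR → QR → QR
    _+ᴿ_ = addR

    _*ᴿ_ : QR → QR → QR
    _*ᴿ_ = mulR b c


    from-IsRoot : ∀ {m} α → IsRoot m b c α → evalF b c α ≈ᴿ ι (+ 0) ⟨mod + m ⟩
    from-IsRoot α (u , v) = componentwise (from-[mod] u) (from-[mod] v)

    to-IsRoot : ∀ {m} α → evalF b c α ≈ᴿ ι (+ 0) ⟨mod + m ⟩ → IsRoot m b c α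
    to-IsRoot α (componentwise u v) = to-[mod] u , to-[mod] v

    eval : QR → Poly → QR
    eval α []      = ι (+ 0)
    eval α (a ∷ p) = ι a +ᴿ α *ᴿ eval α p

    module _ {M : ℤ} where

      +ᴿ-cong : ∀ {X X' Y Y'} → X ≈ᴿ X' ⟨mod M ⟩ → Y ≈ᴿ Y' ⟨mod M ⟩ → X +ᴿ Y ≈ᴿ X' +ᴿ Y' ⟨mod M ⟩
      +ᴿ-cong (componentwise u v) (componentwise u' v') = componentwise (+-cong-mod u u') (+-cong-mod v v')

      *ᴿ-cong : ∀ {X X' Y Y'} → X ≈ᴿ X' ⟨mod M ⟩ → Y ≈ᴿ Y' ⟨mod M ⟩ → X *ᴿ Y ≈ᴿ X' *ᴿ Y' ⟨mod M ⟩
      *ᴿ-cong (componentwise u v) (componentwise u' v') = componentwise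
        (sub-cong-mod (*-cong-mod u u') (*-congˡ-mod c (*-cong-mod v v')))
        (sub-cong-mod (+-cong-mod (*-cong-mod u v') (*-cong-mod u' v)) (*-congˡ-mod b (*-cong-mod v v')))

    private
      +ᴿ-isCommutativeMonoid : IsCommutativeMonoid _+ᴿ_ (ι (+ 0))
      +ᴿ-isCommutativeMonoid = isCommutativeMonoidˡ record
        { isSemigroup = record
          { isMagma = record { isEquivalence = isEquivalence ; ∙-cong = cong₂ _+ᴿ_ }
          ; assoc   = λ { (u , v) (x , x') (z , z') → cong₂ _,_ (ℤ.+-assoc u x z) (ℤ.+-assoc v x' z') } }
        ; identityˡ = λ { (x , x') → cong₂ _,_ (ℤ.+-identityˡ x) (ℤ.+-identityˡ x') }
        ; comm      = λ { (u , v) (x , x') → cong₂ _,_ (ℤ.+-comm u x) (ℤ.+-comm v x') } }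

      *ᴿ-isCommutativeMonoid : IsCommutativeMonoid _*ᴿ_ (ι (+ 1))
      *ᴿ-isCommutativeMonoid = isCommutativeMonoidˡ record
        { isSemigroup = record
          { isMagma = record { isEquivalence = isEquivalence ; ∙-cong = cong₂ _*ᴿ_ }
          ; assoc   = λ { (u , v) (x , x') (z , z') → cong₂ _,_ (*ᴿ-assoc₁ b c u v x x' z z') (*ᴿ-assoc₂ b c u v x x' z z') } }
        ; identityˡ = λ { (x , x') → cong₂ _,_ (solve (c ∷ x ∷ x' ∷ [])) (solve (b ∷ x ∷ x' ∷ [])) }
        ; comm      = λ { (u , v) (x , x') → cong₂ _,_ (solve (c ∷ u ∷ v ∷ x ∷ x' ∷ [])) (solve (b ∷ u ∷ v ∷ x ∷ x' ∷ [])) } }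

    QR-commutativeSemiring : CommutativeSemiring 0ℓ 0ℓ
    QR-commutativeSemiring = record
      { isCommutativeSemiring = isCommutativeSemiringˡ record
        { +-isCommutativeMonoid = +ᴿ-isCommutativeMonoid
        ; *-isCommutativeMonoid = *ᴿ-isCommutativeMonoid
        ; distribʳ = λ { (u , v) (x , x') (z , z') → cong₂ _,_ (*ᴿ-distribʳ₁ b c u v x x' z z') (*ᴿ-distribʳ₂ b c u v x x' z z') }
        ; zeroˡ    = λ { (x , x') → cong₂ _,_ (solve (c ∷ x ∷ x' ∷ [])) (solve (b ∷ x ∷ x' ∷ [])) } } }

    open CommutativeSemiring QR-commutativeSemiring
      using (+-identityˡ; +-identityʳ; +-comm; *-identityʳ; *-assoc; *-comm; distribˡ; distribʳ; zeroˡ; zeroʳ;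
             +-commutativeSemigroup; *-commutativeSemigroup)
    open import Algebra.Properties.CommutativeSemigroup +-commutativeSemigroup using (interchange)
    open import Algebra.Properties.CommutativeSemigroup *-commutativeSemigroup using (x∙yz≈y∙xz)

    ι-* : ∀ e a → ι (e * a) ≡ ι e *ᴿ ι a
    ι-* e a = cong₂ _,_ (solve (b ∷ c ∷ e ∷ a ∷ [])) (solve (b ∷ c ∷ e ∷ a ∷ []))

    y-* : ∀ r₀ r₁ → y *ᴿ (r₀ , r₁) ≡ (- (c * r₁) , r₀ - b * r₁)
    y-* r₀ r₁ = cong₂ _,_ (solve (c ∷ r₀ ∷ r₁ ∷ [])) (solve (b ∷ r₀ ∷ r₁ ∷ []))

    private
      horner-const : ∀ a α → ι a +ᴿ α *ᴿ ι (+ 0) ≡ ι a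
      horner-const a α = trans (cong (ι a +ᴿ_) (zeroʳ α)) (+-identityʳ (ι a))

      horner-⊕ : ∀ A A' α X Y → (A +ᴿ A') +ᴿ α *ᴿ (X +ᴿ Y) ≡ (A +ᴿ α *ᴿ X) +ᴿ (A' +ᴿ α *ᴿ Y)
      horner-⊕ A A' α X Y = trans (cong (A +ᴿ A' +ᴿ_) (distribˡ α X Y)) (interchange A A' (α *ᴿ X) (α *ᴿ Y))

      horner-· : ∀ e a α X → ι (e * a) +ᴿ α *ᴿ (ι e *ᴿ X) ≡ ι e *ᴿ (ι a +ᴿ α *ᴿ X)
      horner-· e a α X = begin
        ι (e * a) +ᴿ α *ᴿ (ι e *ᴿ X)        ≡⟨ cong₂ _+ᴿ_ (ι-* e a) (x∙yz≈y∙xz α (ι e) X) ⟩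
        ι e *ᴿ ι a +ᴿ ι e *ᴿ (α *ᴿ X)       ≡⟨ distribˡ (ι e) (ι a) (α *ᴿ X) ⟨
        ι e *ᴿ (ι a +ᴿ α *ᴿ X)              ∎
        where open ≡-Reasoning

      horner-⊗ : ∀ a α P Q → ι a *ᴿ Q +ᴿ (ι (+ 0) +ᴿ α *ᴿ (P *ᴿ Q)) ≡ (ι a +ᴿ α *ᴿ P) *ᴿ Q
      horner-⊗ a α P Q = begin
        ι a *ᴿ Q +ᴿ (ι (+ 0) +ᴿ α *ᴿ (P *ᴿ Q))  ≡⟨ cong (ι a *ᴿ Q +ᴿ_) (+-identityˡ (α *ᴿ (P *ᴿ Q))) ⟩
        ι a *ᴿ Q +ᴿ α *ᴿ (P *ᴿ Q)              ≡⟨ cong (ι a *ᴿ Q +ᴿ_) (*-assoc α P Q) ⟨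
        ι a *ᴿ Q +ᴿ α *ᴿ P *ᴿ Q                ≡⟨ distribʳ Q (ι a) (α *ᴿ P) ⟨
        (ι a +ᴿ α *ᴿ P) *ᴿ Q                   ∎
        where open ≡-Reasoning

    eval-⊕ : ∀ α p q → eval α (p ⊕ q) ≡ eval α p +ᴿ eval α q
    eval-⊕ α []      q        = sym (+-identityˡ (eval α q))
    eval-⊕ α (a ∷ p) []       = sym (+-identityʳ (eval α (a ∷ p)))
    eval-⊕ α (a ∷ p) (a' ∷ q) = trans (cong (λ Z → ι (a + a') +ᴿ α *ᴿ Z) (eval-⊕ α p q)) (horner-⊕ (ι a) (ι a') α (eval α p) (eval α q))

    eval-· : ∀ α e p → eval α (e · p) ≡ ι e *ᴿ eval α p
    eval-· α e []      = sym (zeroʳ (ι e))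
    eval-· α e (a ∷ p) = trans (cong (λ Z → ι (e * a) +ᴿ α *ᴿ Z) (eval-· α e p)) (horner-· e a α (eval α p))

    eval-⊗ : ∀ α p q → eval α (p ⊗ q) ≡ eval α p *ᴿ eval α q
    eval-⊗ α []      q = sym (zeroˡ (eval α q))
    eval-⊗ α (a ∷ p) q = begin
      eval α (a · q ⊕ (+ 0 ∷ p ⊗ q))                               ≡⟨ eval-⊕ α (a · q) (+ 0 ∷ p ⊗ q) ⟩
      eval α (a · q) +ᴿ (ι (+ 0) +ᴿ α *ᴿ eval α (p ⊗ q))           ≡⟨ cong₂ (λ X Y → X +ᴿ (ι (+ 0) +ᴿ α *ᴿ Y)) (eval-· α a q) (eval-⊗ α p q) ⟩
      ι a *ᴿ eval α q +ᴿ (ι (+ 0) +ᴿ α *ᴿ (eval α p *ᴿ eval α q))  ≡⟨ horner-⊗ a α (eval α p) (eval α q) ⟩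
      eval α (a ∷ p) *ᴿ eval α q                                   ∎
      where open ≡-Reasoning

    eval-X^ : ∀ α n → eval α (X^ n) ≡ powR b c α n
    eval-X^ α zero    = horner-const (+ 1) α
    eval-X^ α (suc n) = trans (+-identityˡ (α *ᴿ eval α (X^ n))) (cong (α *ᴿ_) (eval-X^ α n))

    eval-compose : ∀ α P q → eval α (compose P q) ≡ eval (eval α q) P
    eval-compose α []      q = refl
    eval-compose α (a ∷ P) q = begin
      eval α ((a ∷ []) ⊕ q ⊗ compose P q)                  ≡⟨ eval-⊕ α (a ∷ []) (q ⊗ compose P q) ⟩
      eval α (a ∷ []) +ᴿ eval α (q ⊗ compose P q)          ≡⟨ cong₂ _+ᴿ_ (horner-const a α) (eval-⊗ α q (compose P q)) ⟩
      ι a +ᴿ eval α q *ᴿ eval α (compose P q)              ≡⟨ cong (λ Z → ι a +ᴿ eval α q *ᴿ Z) (eval-compose α P q) ⟩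
      ι a +ᴿ eval α q *ᴿ eval (eval α q) P                 ∎
      where open ≡-Reasoning

    eval-fPoly : ∀ α → eval α (fPoly b c) ≡ evalF b c α
    eval-fPoly α = begin
      ι c +ᴿ α *ᴿ (ι b +ᴿ α *ᴿ (ι (+ 1) +ᴿ α *ᴿ ι (+ 0)))  ≡⟨ cong (λ Z → ι c +ᴿ α *ᴿ (ι b +ᴿ α *ᴿ Z)) (horner-const (+ 1) α) ⟩
      ι c +ᴿ α *ᴿ (ι b +ᴿ α *ᴿ ι (+ 1))                    ≡⟨ cong (λ Z → ι c +ᴿ α *ᴿ (ι b +ᴿ Z)) (*-identityʳ α) ⟩
      ι c +ᴿ α *ᴿ (ι b +ᴿ α)                               ≡⟨ +-comm (ι c) (α *ᴿ (ι b +ᴿ α)) ⟩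
      α *ᴿ (ι b +ᴿ α) +ᴿ ι c                               ≡⟨ cong (_+ᴿ ι c) (distribˡ α (ι b) α) ⟩
      α *ᴿ ι b +ᴿ α *ᴿ α +ᴿ ι c                            ≡⟨ cong (_+ᴿ ι c) (+-comm (α *ᴿ ι b) (α *ᴿ α)) ⟩
      α *ᴿ α +ᴿ α *ᴿ ι b +ᴿ ι c                            ≡⟨ cong (λ Z → α *ᴿ α +ᴿ Z +ᴿ ι c) (*-comm α (ι b)) ⟩
      α *ᴿ α +ᴿ ι b *ᴿ α +ᴿ ι c                            ∎
      where open ≡-Reasoning

    evalF-y : evalF b c y ≡ ι (+ 0)
    evalF-y = cong₂ _,_ (y-root₁ b c) (y-root₂ b c)

    evalF-0 : evalF b c (ι (+ 0)) ≡ ι c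
    evalF-0 = begin
      ι (+ 0) *ᴿ ι (+ 0) +ᴿ ι b *ᴿ ι (+ 0) +ᴿ ι c  ≡⟨ cong₂ (λ S T → S +ᴿ T +ᴿ ι c) (zeroʳ (ι (+ 0))) (zeroʳ (ι b)) ⟩
      ι (+ 0) +ᴿ ι (+ 0) +ᴿ ι c                    ≡⟨ +-identityˡ (ι c) ⟩
      ι c                                          ∎
      where open ≡-Reasoning

    horner-cong : ∀ {M a a' X X'} α → a ≡ a' ⟨mod M ⟩ → X ≈ᴿ X' ⟨mod M ⟩ → ι a +ᴿ α *ᴿ X ≈ᴿ ι a' +ᴿ α *ᴿ X' ⟨mod M ⟩
    horner-cong {a = a} {a'} α a≡a' X≈X' = +ᴿ-cong {X = ι a} {ι a'} (componentwise a≡a' ≡-mod-refl) (*ᴿ-cong (≈ᴿ-refl {X = α}) X≈X')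

    eval-cong : ∀ {M} α {p q} → p ≈ q ⟨modP M ⟩ → eval α p ≈ᴿ eval α q ⟨mod M ⟩
    eval-cong α {[]}    {[]}     _   = ≈ᴿ-refl
    eval-cong α {[]}    {a ∷ q}  p≈q =
      ≈ᴿ-trans (≈ᴿ-reflexive (sym (horner-const (+ 0) α))) (horner-cong α (at p≈q 0) (eval-cong α {[]} {q} (coeffwise (at p≈q ∘ suc))))
    eval-cong α {a ∷ p} {[]}     p≈q =
      ≈ᴿ-trans (horner-cong α (at p≈q 0) (eval-cong α {p} {[]} (coeffwise (at p≈q ∘ suc)))) (≈ᴿ-reflexive (horner-const (+ 0) α))
    eval-cong α {a ∷ p} {a' ∷ q} p≈q = horner-cong α (at p≈q 0) (eval-cong α {p} {q} (coeffwise (at p≈q ∘ suc)))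

    asPoly : QR → Poly
    asPoly (u , v) = u ∷ v ∷ []

    private
      coeff-f⊗ : ∀ R k → coeff (fPoly b c ⊗ R) (suc (suc k)) ≡ c * coeff R (suc (suc k)) + (b * coeff R (suc k) + coeff R k)
      coeff-f⊗ R k = trans (coeff-⊗ (fPoly b c) R (suc (suc k))) (cong (λ z → c * coeff R (suc (suc k)) + (b * coeff R (suc k) + z)) (conv-identityˡ (coeff R) k))

    division-by-f : ∀ G → ∃[ Q ] (coeff G ≗ coeff (fPoly b c ⊗ Q ⊕ asPoly (eval y G)))
    division-by-f [] = [] , λ { 0 → refl ; 1 → refl ; 2 → refl ; (suc (suc (suc k))) → refl }
    division-by-f (a ∷ G) with eval y G | division-by-f G
    ... | (r₀ , r₁) | Q , G≗ = r₁ ∷ Q , λ k → begin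
      coeff (a ∷ G) k                                           ≡⟨ step k ⟩
      coeff (f ⊗ (r₁ ∷ Q)) k + coeff (asPoly remainder) k       ≡⟨ coeff-⊕ (f ⊗ (r₁ ∷ Q)) (asPoly remainder) k ⟨
      coeff (f ⊗ (r₁ ∷ Q) ⊕ asPoly remainder) k                 ≡⟨ cong (λ X → coeff (f ⊗ (r₁ ∷ Q) ⊕ asPoly X) k) eval-∷ ⟨
      coeff (f ⊗ (r₁ ∷ Q) ⊕ asPoly (ι a +ᴿ y *ᴿ (r₀ , r₁))) k  ∎
      where
      open ≡-Reasoning
      f = fPoly b c
      remainder = (a - c * r₁ , r₀ - b * r₁)
      eval-∷ : ι a +ᴿ y *ᴿ (r₀ , r₁) ≡ remainder
      eval-∷ = trans (cong (ι a +ᴿ_) (y-* r₀ r₁)) (cong (a - c * r₁ ,_) (ℤ.+-identityˡ (r₀ - b * r₁)))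
      step : ∀ k → coeff (a ∷ G) k ≡ coeff (f ⊗ (r₁ ∷ Q)) k + coeff (asPoly remainder) k
      step 0 = trans (split₀ a c r₁) (cong (_+ (a - c * r₁)) (sym (coeff-⊗ f (r₁ ∷ Q) 0)))
        where
        split₀ : ∀ a c r₁ → a ≡ c * r₁ + (a - c * r₁)
        split₀ a c r₁ = solve (a ∷ c ∷ r₁ ∷ [])
      step 1 = begin
        coeff G 0                                   ≡⟨ trans (G≗ 0) (coeff-⊕ (f ⊗ Q) (asPoly (r₀ , r₁)) 0) ⟩
        coeff (f ⊗ Q) 0 + r₀                        ≡⟨ cong (_+ r₀) (coeff-⊗ f Q 0) ⟩
        c * coeff Q 0 + r₀                          ≡⟨ split₁ b c (coeff Q 0) r₀ r₁ ⟩
        c * coeff Q 0 + b * r₁ + (r₀ - b * r₁)      ≡⟨ cong (_+ (r₀ - b * r₁)) (coeff-⊗ f (r₁ ∷ Q) 1) ⟨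
        coeff (f ⊗ (r₁ ∷ Q)) 1 + (r₀ - b * r₁)      ∎
        where
        split₁ : ∀ b c q r₀ r₁ → c * q + r₀ ≡ c * q + b * r₁ + (r₀ - b * r₁)
        split₁ b c q r₀ r₁ = solve (b ∷ c ∷ q ∷ r₀ ∷ r₁ ∷ [])
      step 2 = begin
        coeff G 1                                   ≡⟨ trans (G≗ 1) (coeff-⊕ (f ⊗ Q) (asPoly (r₀ , r₁)) 1) ⟩
        coeff (f ⊗ Q) 1 + r₁                        ≡⟨ cong (_+ r₁) (coeff-⊗ f Q 1) ⟩
        c * coeff Q 1 + b * coeff Q 0 + r₁          ≡⟨ reassoc (c * coeff Q 1) (b * coeff Q 0) r₁ ⟩
        c * coeff Q 1 + (b * coeff Q 0 + r₁) + + 0  ≡⟨ cong (_+ + 0) (coeff-f⊗ (r₁ ∷ Q) 0) ⟨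
        coeff (f ⊗ (r₁ ∷ Q)) 2 + + 0                ∎
        where
        reassoc : ∀ u v w → u + v + w ≡ u + (v + w) + + 0
        reassoc u v w = solve (u ∷ v ∷ w ∷ [])
      step (suc (suc (suc k))) = begin
        coeff G (suc (suc k))                       ≡⟨ trans (G≗ (suc (suc k))) (coeff-⊕ (f ⊗ Q) (asPoly (r₀ , r₁)) (suc (suc k))) ⟩
        coeff (f ⊗ Q) (suc (suc k)) + + 0          ≡⟨ cong (_+ + 0) (trans (coeff-f⊗ Q k) (sym (coeff-f⊗ (r₁ ∷ Q) (suc k)))) ⟩
        coeff (f ⊗ (r₁ ∷ Q)) (suc (suc (suc k))) + + 0 ∎

    root-at-y⇒f-divides : ∀ {m} G → eval y G ≈ᴿ ι (+ 0) ⟨mod + m ⟩ → DividesP m (fPoly b c) G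
    root-at-y⇒f-divides {m} G Gy≈0 with division-by-f G
    ... | Q , G≗ = Q , to-[modP] G (fPoly b c ⊗ Q) (begin
      G                                      ≈⟨ ≗⇒≈P G≗ ⟩
      fPoly b c ⊗ Q ⊕ asPoly (eval y G)      ≈⟨ ⊕-cong (≈P-refl {p = fPoly b c ⊗ Q}) remainder≈0 ⟩
      fPoly b c ⊗ Q ⊕ []                     ≈⟨ ≗⇒≈P (λ k → trans (coeff-⊕ (fPoly b c ⊗ Q) [] k) (ℤ.+-identityʳ _)) ⟩
      fPoly b c ⊗ Q                          ∎)
      where
      open SetoidReasoning (≈P-setoid (+ m))
      remainder≈0 : asPoly (eval y G) ≈ [] ⟨modP + m ⟩
      remainder≈0 = coeffwise λ { 0 → fst Gy≈0 ; 1 → snd Gy≈0 ; (suc (suc k)) → ≡-mod-refl }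

    pow-preserves-root : ∀ {M} F k Q α → compose F (X^ k) ≈ F ⊗ Q ⟨modP M ⟩ →
                 eval α F ≈ᴿ ι (+ 0) ⟨mod M ⟩ → eval (powR b c α k) F ≈ᴿ ι (+ 0) ⟨mod M ⟩
    pow-preserves-root {M} F k Q α F∘xᵏ≈F⊗Q αF≈0 = begin
      eval (powR b c α k) F           ≡⟨ cong (λ β → eval β F) (eval-X^ α k) ⟨
      eval (eval α (X^ k)) F          ≡⟨ eval-compose α F (X^ k) ⟨
      eval α (compose F (X^ k))       ≈⟨ eval-cong α F∘xᵏ≈F⊗Q ⟩
      eval α (F ⊗ Q)                  ≡⟨ eval-⊗ α F Q ⟩
      eval α F *ᴿ eval α Q            ≈⟨ *ᴿ-cong αF≈0 (≈ᴿ-refl {X = eval α Q}) ⟩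
      ι (+ 0) *ᴿ eval α Q             ≡⟨ zeroˡ (eval α Q) ⟩
      ι (+ 0)                         ∎
      where open SetoidReasoning (≈ᴿ-setoid M)

    pow-preserves-IsRoot : ∀ {m} F k Q → F ≈ fPoly b c ⟨modP + m ⟩ → compose F (X^ k) ≈ F ⊗ Q ⟨modP + m ⟩ →
                               ∀ α → IsRoot m b c α → IsRoot m b c (powR b c α k)
    pow-preserves-IsRoot {m} F k Q F≈f F∘xᵏ≈F⊗Q α α-root = to-IsRoot (powR b c α k) (begin
      evalF b c (powR b c α k)        ≡⟨ eval-fPoly (powR b c α k) ⟨
      eval (powR b c α k) (fPoly b c) ≈⟨ eval-cong (powR b c α k) (≈P-sym F≈f) ⟩
      eval (powR b c α k) F           ≈⟨ pow-preserves-root F k Q α F∘xᵏ≈F⊗Q αF≈0 ⟩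
      ι (+ 0)                         ∎)
      where
      open SetoidReasoning (≈ᴿ-setoid (+ m))
      αF≈0 : eval α F ≈ᴿ ι (+ 0) ⟨mod + m ⟩
      αF≈0 = begin
        eval α F                      ≈⟨ eval-cong α F≈f ⟩
        eval α (fPoly b c)            ≡⟨ eval-fPoly α ⟩
        evalF b c α                   ≈⟨ from-IsRoot α α-root ⟩
        ι (+ 0)                       ∎

    y-root : ∀ {m} → IsRoot m b c y
    y-root = to-IsRoot y (≈ᴿ-reflexive evalF-y)

    yᵏ-root⇒f∣f∘xᵏ : ∀ {m} k → IsRoot m b c (powR b c y k) → DividesP m (fPoly b c) (compose (fPoly b c) (X^ k))
    yᵏ-root⇒f∣f∘xᵏ {m} k yᵏ-root = root-at-y⇒f-divides (compose (fPoly b c) (X^ k)) (begin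
      eval y (compose (fPoly b c) (X^ k))   ≡⟨ eval-compose y (fPoly b c) (X^ k) ⟩
      eval (eval y (X^ k)) (fPoly b c)      ≡⟨ cong (λ β → eval β (fPoly b c)) (eval-X^ y k) ⟩
      eval (powR b c y k) (fPoly b c)       ≡⟨ eval-fPoly (powR b c y k) ⟩
      evalF b c (powR b c y k)              ≈⟨ from-IsRoot (powR b c y k) yᵏ-root ⟩
      ι (+ 0)                               ∎)
      where open SetoidReasoning (≈ᴿ-setoid (+ m))

    root-at-0⇒≡0 : ∀ {m} → IsRoot m b c (ι (+ 0)) → c ≡ + 0 ⟨mod + m ⟩
    root-at-0⇒≡0 root = ≡-mod-resp (cong proj₁ (sym evalF-0)) refl (fst (from-IsRoot (ι (+ 0)) root))

    ≡0⇒root-at-0 : ∀ {m} → c ≡ + 0 ⟨mod + m ⟩ → IsRoot m b c (ι (+ 0))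
    ≡0⇒root-at-0 c≡0 = to-IsRoot (ι (+ 0)) (≈ᴿ-trans (≈ᴿ-reflexive evalF-0) (componentwise c≡0 ≡-mod-refl))

module PrimePower where

  open import Data.Nat using (_*_; _^_; NonZero; _≟_)
  open import Data.Nat.Divisibility using (_∣?_)
  open import Data.Nat.Primality using (prime⇒irreducible; prime⇒nonZero; prime⇒nonTrivial)
  open import Data.Nat.Primality.Factorisation using (factorise)
  open import Data.Nat.Induction using (<-rec)
  open import Algebra.Properties.CommutativeSemigroup ℕ.*-commutativeSemigroup using () renaming (x∙yz≈y∙xz to ℕ-*-left-comm)
  open import Algebra.Properties.CommutativeSemigroup ℤ.*-commutativeSemigroup using () renaming (x∙yz≈y∙xz to ℤ-*-left-comm)
  open import Data.Nat.ListAction using (product)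
  open import Data.List.Relation.Unary.All using (_∷_)
  open import Data.Sum using (inj₁; inj₂)
  open import Data.Empty using (⊥; ⊥-elim)
  open import Relation.Nullary using (yes; no)
  open import Function using (_∘′_)

  prime>1 : ∀ {p} → Prime p → 1 < p
  prime>1 {p} p-prime = ℕ.nonTrivial⇒n>1 p {{prime⇒nonTrivial p-prime}}

  prime-divisor : ∀ {n} → 1 < n → ∃[ p ] (Prime p × p ∣ n)
  prime-divisor {n} 1<n with factorise n {{ℕ.>-nonZero (ℕ.<-trans (s≤s z≤n) 1<n)}}
  ... | record { factors = [] ; isFactorisation = n≡1 } = contradiction n≡1 (ℕ.>⇒≢ 1<n)
  ... | record { factors = p ∷ ps ; isFactorisation = n≡p*ps ; factorsPrime = p-prime ∷ _ } =
    p , p-prime , divides (product ps) (trans n≡p*ps (ℕ.*-comm p (product ps)))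

  coprime-if-no-common-prime : ∀ {a b} → a ≢ 0 → (∀ {t} → Prime t → t ∣ a → t ∣ b → ⊥) → Coprime a b
  coprime-if-no-common-prime a≢0 _ {0}           (0∣a , _)   = contradiction (ℕD.0∣⇒≡0 0∣a) a≢0
  coprime-if-no-common-prime _   _ {1}           _           = refl
  coprime-if-no-common-prime _   H {suc (suc d)} (d∣a , d∣b) with prime-divisor {suc (suc d)} (s≤s (s≤s z≤n))
  ... | t , t-prime , t∣d = ⊥-elim (H t-prime (∣-trans t∣d d∣a) (∣-trans t∣d d∣b))

  prime-∣-prime : ∀ {t p} → Prime t → Prime p → t ∣ p → t ≡ p
  prime-∣-prime t-prime p-prime t∣p with prime⇒irreducible p-prime t∣p
  ... | inj₁ t≡1 = contradiction t≡1 (ℕ.>⇒≢ (prime>1 t-prime))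
  ... | inj₂ t≡p = t≡p

  prime-∣-prime^ : ∀ {t p} r → Prime t → Prime p → t ∣ p ^ r → t ≡ p
  prime-∣-prime^ zero    t-prime _       t∣1 = contradiction (ℕD.∣1⇒≡1 t∣1) (ℕ.>⇒≢ (prime>1 t-prime))
  prime-∣-prime^ {p = p} (suc r) t-prime p-prime t∣p^r+1 with euclidsLemma p (p ^ r) t-prime t∣p^r+1
  ... | inj₁ t∣p   = prime-∣-prime t-prime p-prime t∣p
  ... | inj₂ t∣p^r = prime-∣-prime^ r t-prime p-prime t∣p^r

  prime^-coprime : ∀ {p k} r → Prime p → p ∤ k → Coprime (p ^ r) k
  prime^-coprime {p} r p-prime p∤k =
    coprime-if-no-common-prime (ℕ.≢-nonZero⁻¹ (p ^ r) {{ℕ.m^n≢0 p r {{prime⇒nonZero p-prime}}}})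
      λ t-prime t∣p^r t∣k → p∤k (subst (_∣ _) (prime-∣-prime^ r t-prime p-prime t∣p^r) t∣k)

  prime-power-part : ∀ {p} → Prime p → ∀ n → .{{NonZero n}} → ∃[ r ] ∃[ k ] (n ≡ p ^ r * k × p ∤ k)
  prime-power-part {p} p-prime = <-rec P split
    where
    P : ℕ → Set
    P n = .{{NonZero n}} → ∃[ r ] ∃[ k ] (n ≡ p ^ r * k × p ∤ k)
    split : ∀ n → (∀ {m} → m < n → P m) → P n
    split n rec with p ∣? n
    ... | no p∤n = 0 , n , sym (ℕ.+-identityʳ n) , p∤n
    ... | yes (divides q refl) with rec {q} (ℕ.m<m*n q p {{ℕ.m*n≢0⇒m≢0 q}} (prime>1 p-prime)) {{ℕ.m*n≢0⇒m≢0 q}}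
    ...   | r , k , q≡p^r*k , p∤k = suc r , k , q*p≡ , p∤k
      where
      q*p≡ : q * p ≡ p ^ suc r * k
      q*p≡ = begin
        q * p             ≡⟨ cong (_* p) q≡p^r*k ⟩
        p ^ r * k * p     ≡⟨ ℕ.*-comm (p ^ r * k) p ⟩
        p * (p ^ r * k)   ≡⟨ ℕ.*-assoc p (p ^ r) k ⟨
        p ^ suc r * k     ∎
        where open ≡-Reasoning

  exact-power-∣-cofactor : ∀ {p q r s k} → Prime p → p ∤ k → ExactPrimePower q s k → ExactPrimePower q s (p ^ r * k)
  exact-power-∣-cofactor {p} {q} {r} {suc s} {k} p-prime p∤k (q-prime , 1≤s , q^s∣k , q^s+1∤k) =
    q-prime , 1≤s , ∣-trans q^s∣k (ℕD.n∣m*n (p ^ r)) , q^s+1∤p^r*k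
    where
    q∤p^r : q ∤ p ^ r
    q∤p^r q∣p^r = p∤k (subst (_∣ k) (prime-∣-prime^ r q-prime p-prime q∣p^r) (∣-trans (ℕD.m∣m*n (q ^ s)) q^s∣k))
    q^s+1∤p^r*k : q ^ suc (suc s) ∤ p ^ r * k
    q^s+1∤p^r*k = q^s+1∤k ∘′ coprime-divisor (prime^-coprime (suc (suc s)) q-prime q∤p^r)

  prime-power-induction : (P : ℕ → Set) → P 1 → (∀ {a b} → Coprime a b → P a → P b → P (a * b)) →
                          ∀ n → .{{NonZero n}} → (∀ p r → ExactPrimePower p r n → P (p ^ r)) → P n
  prime-power-induction P P-1 P-* = <-rec Q step
    where
    Q : ℕ → Set
    Q n = .{{NonZero n}} → (∀ p r → ExactPrimePower p r n → P (p ^ r)) → P n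
    step : ∀ n → (∀ {m} → m < n → Q m) → Q n
    step 1               _   _     = P-1
    step n@(suc (suc _)) rec P-local with prime-divisor {n} (s≤s (s≤s z≤n))
    ... | p , p-prime , p∣n with prime-power-part p-prime n
    ...   | zero    , k , n≡k       , p∤k = contradiction (subst (p ∣_) (trans n≡k (ℕ.*-identityˡ k)) p∣n) p∤k
    ...   | suc r₀ , k , n≡p^r*k , p∤k =
      subst P (sym n≡p^r*k) (P-* (prime^-coprime r p-prime p∤k) (P-local p r exact) (rec k<n {{k≢0}} P-cofactor))
      where
      r = suc r₀
      instance
        p^r≢0 : NonZero (p ^ r)
        p^r≢0 = ℕ.m^n≢0 p r {{prime⇒nonZero p-prime}}
      k≢0 : NonZero k
      k≢0 = ℕ.m*n≢0⇒n≢0 (p ^ r) {{subst NonZero n≡p^r*k _}}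
      1<p^r : 1 < p ^ r
      1<p^r = ℕ.<-≤-trans (prime>1 p-prime) (ℕ.m≤m*n p (p ^ r₀) {{ℕ.m^n≢0 p r₀ {{prime⇒nonZero p-prime}}}})
      k<n : k < n
      k<n = subst (k <_) (trans (ℕ.*-comm k (p ^ r)) (sym n≡p^r*k)) (ℕ.m<m*n k (p ^ r) {{k≢0}} 1<p^r)
      exact : ExactPrimePower p r n
      exact = p-prime , s≤s z≤n , divides k (trans n≡p^r*k (ℕ.*-comm (p ^ r) k)) , p^r+1∤n
        where
        p^r+1∤n : p ^ suc r ∤ n
        p^r+1∤n p^r+1∣n = p∤k (ℕD.*-cancelˡ-∣ (p ^ r)
          (subst₂ _∣_ (ℕ.*-comm p (p ^ r)) n≡p^r*k p^r+1∣n))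
      P-cofactor : ∀ q s → ExactPrimePower q s k → P (q ^ s)
      P-cofactor q s exact-k = P-local q s (subst (ExactPrimePower q s) (sym n≡p^r*k) (exact-power-∣-cofactor {r = r} p-prime p∤k exact-k))

  Legendre-functional : ∀ {a p s t} → Legendre a p s → Legendre a p t → s ≡ t
  Legendre-functional (leg-zero _)     (leg-zero _)     = refl
  Legendre-functional (leg-zero p∣a)   (leg-res p∤a _)  = contradiction p∣a p∤a
  Legendre-functional (leg-zero p∣a)   (leg-non p∤a _)  = contradiction p∣a p∤a
  Legendre-functional (leg-res p∤a _)  (leg-zero p∣a)   = contradiction p∣a p∤a
  Legendre-functional (leg-res _ _)    (leg-res _ _)    = refl
  Legendre-functional (leg-res _ sq)   (leg-non _ ¬sq)  = contradiction sq ¬sq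
  Legendre-functional (leg-non p∤a _)  (leg-zero p∣a)   = contradiction p∣a p∤a
  Legendre-functional (leg-non _ ¬sq)  (leg-res _ sq)   = contradiction sq ¬sq
  Legendre-functional (leg-non _ _)    (leg-non _ _)    = refl

  Jacobi-1 : ∀ {a n s} → Jacobi a n s → n ≡ 1 → s ≡ + 1
  Jacobi-1 jac-one                        _     = refl
  Jacobi-1 (jac-mul {p} {m} p-prime _ _ _) pm≡1 =
    contradiction (ℕD.∣1⇒≡1 (divides m (trans (sym pm≡1) (ℕ.*-comm p m)))) (ℕ.>⇒≢ (prime>1 p-prime))

  Jacobi-remove-prime : ∀ {a N s q t M} → Jacobi a N s → Prime q → Legendre a q t → N ≡ q * M →
                        ∃[ s' ] (Jacobi a M s' × s ≡ t ℤ.* s')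
  Jacobi-remove-prime {q = q} {M = M} jac-one q-prime _ 1≡qM =
    contradiction (ℕD.∣1⇒≡1 (divides M (trans 1≡qM (ℕ.*-comm q M)))) (ℕ.>⇒≢ (prime>1 q-prime))
  Jacobi-remove-prime {a} {q = q} {t} {M} (jac-mul {p} {m} {s} {t₁} p-prime p-odd leg J) q-prime leg' pm≡qM with p ≟ q
  ... | yes refl = s , subst (λ k → Jacobi a k s) (ℕ.*-cancelˡ-≡ m M p {{prime⇒nonZero p-prime}} pm≡qM) J ,
                   cong (ℤ._* s) (Legendre-functional leg leg')
  ... | no p≢q with euclidsLemma p m q-prime (divides M (trans pm≡qM (ℕ.*-comm q M)))
  ...   | inj₁ q∣p = contradiction (sym (prime-∣-prime q-prime p-prime q∣p)) p≢q
  ...   | inj₂ (divides m' refl) with Jacobi-remove-prime J q-prime leg' (ℕ.*-comm m' q)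
  ...     | s' , J' , s≡ts' = t₁ ℤ.* s' , subst (λ k → Jacobi a k (t₁ ℤ.* s')) pm'≡M (jac-mul p-prime p-odd leg J') , s≡
    where
    pm'≡M : p * m' ≡ M
    pm'≡M = ℕ.*-cancelˡ-≡ (p * m') M q {{prime⇒nonZero q-prime}} (begin
      q * (p * m')   ≡⟨ ℕ-*-left-comm q p m' ⟩
      p * (q * m')   ≡⟨ cong (p *_) (ℕ.*-comm q m') ⟩
      p * (m' * q)   ≡⟨ pm≡qM ⟩
      q * M          ∎)
      where open ≡-Reasoning
    s≡ : t₁ ℤ.* s ≡ t ℤ.* (t₁ ℤ.* s')
    s≡ = trans (cong (t₁ ℤ.*_) s≡ts') (ℤ-*-left-comm t₁ t s')

  Jacobi-functional : ∀ {a n s s'} → Jacobi a n s → Jacobi a n s' → s ≡ s'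
  Jacobi-functional jac-one J' = sym (Jacobi-1 J' refl)
  Jacobi-functional (jac-mul {t = t} p-prime _ leg J) J' with Jacobi-remove-prime J' p-prime leg refl
  ... | s'' , J'' , s'≡ts'' = trans (cong (t ℤ.*_) (Jacobi-functional J J'')) (sym s'≡ts'')

open Congruence
open Polynomial
open CommonDivisor
open QuadraticExtension
open PrimePower

degree-0-cofactor : ∀ d₁ d → d₁ ℕ.+ d ≡ 2 → (- (+ 1)) ℤ.^ (d ℕ./ 2) ≡ - (+ 1) → d₁ ≡ 0
degree-0-cofactor zero     _             _      _  = refl
degree-0-cofactor (suc d₁) 0             _      ()
degree-0-cofactor (suc d₁) 1             _      ()
degree-0-cofactor (suc d₁) (suc (suc d)) d₁+d≡2 _  =
  contradiction (subst (suc (suc d) <_) d₁+d≡2 (ℕ.m<n+m (suc (suc d)) {suc d₁} (s≤s z≤n))) λ { (s≤s (s≤s ())) }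

unit-mod⇒coprime : ∀ {n} D → UnitMod n D → Coprime n ∣ D ∣
unit-mod⇒coprime D (u , Du≡1) {t} (t∣n , t∣D) = 1≡0-mod⇒≡1 (begin
  + 1        ≈⟨ ≡-mod-sym (≡-mod-∣ (ℤS.∣ᵤ⇒∣ t∣n) (from-[mod] {a = D ℤ.* u} Du≡1)) ⟩
  D ℤ.* u    ≈⟨ *-cong-mod (∣⇒≡0-mod {a = D} t∣D) (≡-mod-refl {a = u}) ⟩
  + 0 ℤ.* u  ≡⟨ ℤ.*-zeroˡ u ⟩
  + 0        ∎)
  where open SetoidReasoning (≡-mod-setoid (+ t))

coprime-abs-*ʳ : ∀ {n} a b → Coprime n ∣ a ℤ.* b ∣ → Coprime n ∣ b ∣
coprime-abs-*ʳ a b n⊥ab (i∣n , i∣b) = n⊥ab (i∣n , subst (_ ∣_) (sym (ℤ.abs-* a b)) (ℕD.∣n⇒∣m*n ∣ a ∣ i∣b))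

quadratic-factor-constant : ∀ {m f F₁ f₁ d₁ d} → 1 < m → MonicOfDegree (+ m) (coeff f) 2 → f ≈ F₁ ⊗ f₁ ⟨modP + m ⟩ →
                            MonicOfDegree (+ m) (coeff F₁) d₁ → MonicOfDegree (+ m) (coeff f₁) d →
                            (- (+ 1)) ℤ.^ (d ℕ./ 2) ≡ - (+ 1) → F₁ ≈ oneP ⟨modP + m ⟩
quadratic-factor-constant {F₁ = F₁} {f₁} {d₁} {d} 1<m f-monic f≈F₁f₁ F₁-monic f₁-monic sign =
  degree-0⇒≈oneP (subst (MonicOfDegree _ (coeff F₁)) d₁≡0 F₁-monic)
  where
  d₁+d≡2 : d₁ ℕ.+ d ≡ 2
  d₁+d≡2 = MonicOfDegree-unique 1<m (MonicOfDegree-cong (at (≈P-sym f≈F₁f₁)) (MonicOfDegree-⊗ {p = F₁} {f₁} F₁-monic f₁-monic)) f-monic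
  d₁≡0 : d₁ ≡ 0
  d₁≡0 = degree-0-cofactor d₁ d d₁+d≡2 sign

module _ {n : ℕ} {b c : ℤ} where

  private
    f = fPoly b c
    Δ = disc b c

  frobenius⇒conditions : Jacobi Δ n (- (+ 1)) → FrobeniusPP2 n b c →
                         Cond1 n b c × Cond2 n b c × Cond3 n b c × Cond4 n b c
  frobenius⇒conditions J (n-composite , n⊥cΔ , F₁ , f₁ , F₂ , f₂ , gcmd₁ , f≈F₁f₁ , gcmd₂ , f₁≈F₂f₂ , f₂≈1 ,
                          (Q , F₂∘xⁿ≈F₂Q) , d , F₂-monic , J') =
    (coprime⇒unit-mod Δ (coprime-abs-*ʳ c Δ n⊥cΔ) , no-root-at-0) ,
    (λ p r e → Gcmd-∣ (xn-x n) f oneP (p^r∣n e) (Gcmd-cong (xn-x n) f F₁ (≈P-refl {p = f}) F₁≈1 gcmd₁)) ,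
    (λ p r e → Gcmd-∣ (xn-x (n ℕ.* n)) f f (p^r∣n e) (Gcmd-cong (xn-x (n ℕ.* n)) f₁ F₂ (≈P-sym f≈f₁) F₂≈f gcmd₂)) ,
    (λ p r e → pow-preserves-IsRoot b c F₂ n Q (≈P-∣ (p^r∣ₛn e) F₂≈f)
                 (≈P-∣ (p^r∣ₛn e) (from-[modP] (compose F₂ (X^ n)) (F₂ ⊗ Q) F₂∘xⁿ≈F₂Q)))
    where
    open SetoidReasoning (≈P-setoid (+ n))
    p^r∣n : ∀ {p r} → ExactPrimePower p r n → p ℕ.^ r ∣ n
    p^r∣n (_ , _ , p^r∣n , _) = p^r∣n
    p^r∣ₛn : ∀ {p r} → ExactPrimePower p r n → + (p ℕ.^ r) ℤS.∣ + n
    p^r∣ₛn = ℤS.∣ᵤ⇒∣ ∘ p^r∣n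
    no-root-at-0 : ∀ p → Prime p → p ∣ n → ¬ IsRoot p b c (+ 0 , + 0)
    no-root-at-0 p p-prime p∣n root = ℕ.>⇒≢ (prime>1 p-prime) (n⊥cΔ (p∣n , p∣cΔ))
      where
      p∣cΔ : p ∣ ∣ c ℤ.* Δ ∣
      p∣cΔ = subst (p ∣_) (sym (ℤ.abs-* c Δ)) (ℕD.∣m⇒∣m*n ∣ Δ ∣ (≡0-mod⇒∣ (root-at-0⇒≡0 b c root)))
    f₁≈F₂ : f₁ ≈ F₂ ⟨modP + n ⟩
    f₁≈F₂ = begin
      f₁        ≈⟨ from-[modP] f₁ (F₂ ⊗ f₂) f₁≈F₂f₂ ⟩
      F₂ ⊗ f₂   ≈⟨ ⊗-cong (≈P-refl {p = F₂}) (from-[modP] f₂ oneP f₂≈1) ⟩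
      F₂ ⊗ oneP ≈⟨ ≗⇒≈P (⊗-identityʳ F₂) ⟩
      F₂        ∎
    F₁≈1 : F₁ ≈ oneP ⟨modP + n ⟩
    F₁≈1 = quadratic-factor-constant (ℕ.nonTrivial⇒n>1 n {{composite⇒nonTrivial n-composite}})
             (fPoly-monic b c) (from-[modP] f (F₁ ⊗ f₁) f≈F₁f₁) (from-MonicDeg F₁ (proj₂ (proj₁ gcmd₁)))
             (MonicOfDegree-cong (at (≈P-sym f₁≈F₂)) (from-MonicDeg F₂ F₂-monic)) (Jacobi-functional J' J)
    f≈f₁ : f ≈ f₁ ⟨modP + n ⟩
    f≈f₁ = begin
      f         ≈⟨ from-[modP] f (F₁ ⊗ f₁) f≈F₁f₁ ⟩
      F₁ ⊗ f₁   ≈⟨ ⊗-cong F₁≈1 (≈P-refl {p = f₁}) ⟩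
      oneP ⊗ f₁ ≈⟨ ≗⇒≈P (⊗-identityˡ f₁) ⟩
      f₁        ∎
    F₂≈f : F₂ ≈ f ⟨modP + n ⟩
    F₂≈f = ≈P-sym (≈P-trans f≈f₁ f₁≈F₂)

  conditions⇒frobenius : Composite n → Jacobi Δ n (- (+ 1)) →
                         Cond1 n b c × Cond2 n b c × Cond3 n b c × Cond4 n b c → FrobeniusPP2 n b c
  conditions⇒frobenius n-composite J ((Δ-unit , no-root-at-0) , cond2 , cond3 , cond4) =
    n-composite , n⊥cΔ , oneP , f , f , oneP ,
    gcmd₁ , to-[modP] f (oneP ⊗ f) (≗⇒≈P (sym ∘ ⊗-identityˡ f)) ,
    gcmd₂ , to-[modP] f (f ⊗ oneP) (≗⇒≈P (sym ∘ ⊗-identityʳ f)) ,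
    to-[modP] oneP oneP ≈P-refl , f∣f∘xⁿ , 2 , to-MonicDeg f (fPoly-monic b c) , J
    where
    instance
      n≢0 : ℕ.NonZero n
      n≢0 = composite⇒nonZero n-composite
    n⊥cΔ : Coprime n ∣ c ℤ.* Δ ∣
    n⊥cΔ = coprime-if-no-common-prime (ℕ.≢-nonZero⁻¹ n) λ {t} t-prime t∣n t∣cΔ →
      [ (λ t∣c → no-root-at-0 t t-prime t∣n (≡0⇒root-at-0 b c (∣⇒≡0-mod {a = c} t∣c)))
      , (λ t∣Δ → ℕ.>⇒≢ (prime>1 t-prime) (unit-mod⇒coprime Δ Δ-unit (t∣n , t∣Δ))) ]′
      (euclidsLemma ∣ c ∣ ∣ Δ ∣ t-prime (subst (t ∣_) (ℤ.abs-* c Δ) t∣cΔ))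
    Local : ℕ → Set
    Local m = Gcmd m (xn-x n) f oneP × Gcmd m (xn-x (n ℕ.* n)) f f × DividesP m f (compose f (X^ n))
    glue : ∀ {a a'} → Coprime a a' → Local a → Local a' → Local (a ℕ.* a')
    glue cop (g₁ , g₂ , f∣) (g₁' , g₂' , f∣') =
      Gcmd-crt (xn-x n) f oneP cop (0 , to-MonicDeg oneP oneP-monic) g₁ g₁' ,
      Gcmd-crt (xn-x (n ℕ.* n)) f f cop (2 , to-MonicDeg f (fPoly-monic b c)) g₂ g₂' ,
      DividesP-crt f (compose f (X^ n)) cop f∣ f∣'
    local-global : Local n
    local-global = prime-power-induction Local
      (Gcmd-1 (xn-x n) f oneP (0 , to-MonicDeg oneP oneP-monic) , Gcmd-1 (xn-x (n ℕ.* n)) f f (2 , to-MonicDeg f (fPoly-monic b c)) , DividesP-1 f (compose f (X^ n)))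
      glue n λ p r e → cond2 p r e , cond3 p r e , yᵏ-root⇒f∣f∘xᵏ b c n (cond4 p r e y (y-root b c))
    gcmd₁ = proj₁ local-global
    gcmd₂ = proj₁ (proj₂ local-global)
    f∣f∘xⁿ = proj₂ (proj₂ local-global)

proposition2p5 : (n : ℕ) (b c : ℤ) → Composite n →
    Jacobi (disc b c) n (- (+ 1)) →
    FrobeniusPP2 n b c ⇔ (Cond1 n b c × Cond2 n b c × Cond3 n b c × Cond4 n b c)
proposition2p5 n b c n-composite J = mk⇔ (frobenius⇒conditions J) (conditions⇒frobenius n-composite J)
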